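{- Let $(G,a,b)$ be a valid instance such that $G$ has at least one edge. Then there exists an edge $e$ of $G$ with ends $a$ and $a'$ (possibly $a=a'$) such that $(G_e,a',b)$ is a valid instance.
   Context: Graphs are finite, undirected, with parallel edges and loops allowed. For a set of vertices $X$, $\delta(X)$ is the set of edges with exactly one end in $X$. A graph is $3$-edge-connected if it has no proper non-empty vertex set $X$ with $|\delta(X)|\le 2$ (so a one-vertex graph is $3$-edge-connected). An Eulerian trail from $a$ to $b$ is a trail (sequence of oriented edges with distinct underlying edges, head of each equal to tail of the next) using every edge exactly once, starting at $a$ and ending at $b$. A valid instance is a tuple $(G,a,b)$ where $G$ is a $3$-edge-connected graph and $a,b$ are vertices of $G$ such that $G$ has an Eulerian trail from $a$ to $b$. Smoothing a vertex $v$: if $v$ is incident to exactly two edges and neither is a loop, delete $v$ and add a new edge joining the other ends of these two edges; otherwise do nothing. For an edge $e$ incident to $a$, $G_e$ denotes the graph obtained from $G$ by deleting $e$ and then smoothing $a$. -}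

module Defs where

open import Data.Nat using (ℕ; zero; suc; _≤_; pred)
open import Data.Fin using (Fin; punchIn; _≟_)
open import Data.Bool using (Bool; true; false; if_then_else_; _xor_; _∨_)
open import Data.Product using (_×_; _,_; proj₁; proj₂; ∃; Σ)
open import Data.Sum using (_⊎_)
open import Data.List using (List; []; _∷_; map; filter; allFin)
open import Data.Nat.ListAction using (sum)
open import Data.List.Relation.Binary.Permutation.Propositional using (_↭_)
open import Relation.Binary.PropositionalEquality using (_≡_)
open import Relation.Nullary using (does; ¬_)
open import Function using (_∘_)

-- The vertex set is the set of v : Fin n with present v ≡ true
-- (a sub-collection of Fin n, so that deleting a vertex does not
-- require renumbering the remaining vertices).
-- Edges are Fin m; edge e joins proj₁ (ends e) and proj₂ (ends e)
-- (the orientation of the pair carries no meaning).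
record Graph : Set where
  constructor graph
  field
    n       : ℕ
    m       : ℕ
    present : Fin n → Bool
    ends    : Fin m → Fin n × Fin n
open Graph public

IsVertex : (G : Graph) → Fin (n G) → Set
IsVertex G v = present G v ≡ true

WellFormed : Graph → Set
WellFormed G = ∀ e → IsVertex G (proj₁ (ends G e)) × IsVertex G (proj₂ (ends G e))

cutSize : (G : Graph) → (Fin (n G) → Bool) → ℕ
cutSize G X = sum (map (λ e → if X (proj₁ (ends G e)) xor X (proj₂ (ends G e)) then 1 else 0) (allFin (m G)))

ThreeEdgeConnected : Graph → Set
ThreeEdgeConnected G =
  (X : Fin (n G) → Bool) →
  (∀ v → X v ≡ true → IsVertex G v) →
  (∃ λ v → X v ≡ true) →
  (∃ λ w → IsVertex G w × X w ≡ false) →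
  3 ≤ cutSize G X

tailO : (G : Graph) → Fin (m G) × Bool → Fin (n G)
tailO G (e , false) = proj₁ (ends G e)
tailO G (e , true)  = proj₂ (ends G e)

headO : (G : Graph) → Fin (m G) × Bool → Fin (n G)
headO G (e , false) = proj₂ (ends G e)
headO G (e , true)  = proj₁ (ends G e)

WalkFromTo : (G : Graph) → Fin (n G) → List (Fin (m G) × Bool) → Fin (n G) → Set
WalkFromTo G a []       b = a ≡ b
WalkFromTo G a (s ∷ ss) b = tailO G s ≡ a × WalkFromTo G (headO G s) ss b

EulerianTrail : (G : Graph) → Fin (n G) → Fin (n G) → List (Fin (m G) × Bool) → Set
EulerianTrail G a b t = WalkFromTo G a t b × (map proj₁ t ↭ allFin (m G))

HasEulerianTrail : (G : Graph) → Fin (n G) → Fin (n G) → Set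
HasEulerianTrail G a b = ∃ λ t → EulerianTrail G a b t

ValidInstance : (G : Graph) → Fin (n G) → Fin (n G) → Set
ValidInstance G a b =
  WellFormed G × IsVertex G a × IsVertex G b × ThreeEdgeConnected G × HasEulerianTrail G a b

dropAt : {A : Set} (k : ℕ) → (Fin k → A) → Fin k → Fin (pred k) → A
dropAt zero    f ()
dropAt (suc k) f e = f ∘ punchIn e

deleteEdge : (G : Graph) → Fin (m G) → Graph
deleteEdge G e = graph (n G) (pred (m G)) (present G) (dropAt (m G) (ends G) e)

isIncident : (G : Graph) → Fin (n G) → Fin (m G) → Bool
isIncident G v e = does (proj₁ (ends G e) ≟ v) ∨ does (proj₂ (ends G e) ≟ v)

isLoop : (G : Graph) → Fin (m G) → Bool
isLoop G e = does (proj₁ (ends G e) ≟ proj₂ (ends G e))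

-- the end of e other than v (for a non-loop edge incident to v)
otherEnd : (G : Graph) → Fin (n G) → Fin (m G) → Fin (n G)
otherEnd G v e = if does (proj₁ (ends G e) ≟ v) then proj₂ (ends G e) else proj₁ (ends G e)

GraphData : ℕ → Set
GraphData k = (Fin k → Bool) × Σ ℕ (λ l → Fin l → Fin k × Fin k)

-- Replace edges f₁, f₂ (both incident to v, non-loops, f₁ ≠ f₂) by one new edge
-- joining their other ends (stored at the position of f₁), and delete v.
mergeAt : (G : Graph) → Fin (n G) → Fin (m G) → Fin (m G) → GraphData (n G)
mergeAt G v f₁ f₂ =
  (λ u → if does (u ≟ v) then false else present G u) ,
  (pred (m G) , dropAt (m G) newEnds f₂)
  where
  newEnds : Fin (m G) → Fin (n G) × Fin (n G)
  newEnds g = if does (g ≟ f₁) then (otherEnd G v f₁ , otherEnd G v f₂) else ends G g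

unchanged : (G : Graph) → GraphData (n G)
unchanged G = present G , (m G , ends G)

smoothWith : (G : Graph) → Fin (n G) → List (Fin (m G)) → GraphData (n G)
smoothWith G v (f₁ ∷ f₂ ∷ []) = if isLoop G f₁ ∨ isLoop G f₂ then unchanged G else mergeAt G v f₁ f₂
smoothWith G v _              = unchanged G

smooth : (G : Graph) → Fin (n G) → Graph
smooth G v = graph (n G) (proj₁ (proj₂ D)) (proj₁ D) (proj₂ (proj₂ D))
  where
  open import Data.Bool.Properties using () renaming (_≟_ to _≟ᵇ_)
  D : GraphData (n G)
  D = smoothWith G v (filter (λ e → isIncident G v e ≟ᵇ true) (allFin (m G)))

Gₑ : (G : Graph) → Fin (n G) → Fin (m G) → Graph
Gₑ G a e = smooth (deleteEdge G e) a

-- If a carries a loop, delete it: no cut changes, and a cannot become a smoothable vertex of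
-- degree two, as {a} spans a cut of size at least 3.  Otherwise, since G has an Eulerian trail from
-- a to b, a cut is odd exactly when it separates a from b; so a tight set, a 3-edge cut containing
-- a and some other vertex, never contains b.  Uncrossing with the sub- and posimodularity of cuts
-- shows that tight sets are closed under intersection.  In the least tight set L the set L ∖ {a}
-- is an even cut, hence of size at least 4, so some edge e joins a to a vertex a′ ∈ L (with no tight
-- set, any edge at a will do).  Then e crosses no 3-edge cut separating two vertices other than a,
-- so all such cuts keep at least 3 edges in G − e.  Smoothing a merely merges its two edges, so
-- every cut of the result is such a cut of G − e; if a is not smoothed, {a} still has 3 or more.
-- The trail survives as well: either it traverses e from a′ to a, and reversing its part before e
-- gives a trail from a′, or its part before e is a closed walk at a, which meets the rest of the
-- trail since otherwise its vertices would span a cut crossed by e alone.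

module Submission where

open import Defs
open import Data.Nat using (ℕ; zero; suc; _+_; _≤_; _<_; z≤n; s≤s)
open import Data.Nat.Properties
  using (+-0-commutativeMonoid; +-assoc; +-identityʳ; +-mono-≤; ≤-refl; ≤-trans; ≤-reflexive;
         ≤ᵇ⇒≤; <⇒≱; ≰⇒>; ≤-pred; ≤∧≢⇒<; _≤?_; +-cancelʳ-≤; +-mono-<-≤; +-monoʳ-≤; <-irrefl; ≤-antisym;
         module ≤-Reasoning)
  renaming (_≟_ to _≟ℕ_)
open import Data.Nat.Induction using (<-wellFounded)
open import Induction.WellFounded using (Acc; acc)
open import Algebra.Properties.CommutativeMonoid.Sum +-0-commutativeMonoid
  using (sum; sum-cong-≗; sum-remove; ∑-distrib-+; sum-replicate-zero)
import Data.Nat.ListAction as List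
open import Data.Fin using (Fin; zero; suc; punchIn; punchOut; _≟_)
import Data.Vec as Vec
import Data.Vec.Properties as Vec
open import Data.Fin.Subset.Properties using (anySubset?)
open import Data.Fin.Properties
  using (any?; all?; ¬∀⟶∃¬; punchInᵢ≢i; punchOut-cong; punchOut-punchIn; punchIn-punchOut; punchIn-injective)
open import Data.Bool using (Bool; true; false; not; _∧_; _∨_; _xor_; if_then_else_)
open import Data.Bool.Properties
  using (not-distribˡ-xor; xor-comm; xor-assoc; xor-same; ∧-identityʳ; ∧-zeroʳ; ∨-identityʳ; ∨-zeroʳ; ¬-not)
  renaming (_≟_ to _≟ᵇ_)
open import Data.Product using (_×_; _,_; proj₁; proj₂; ∃; map₁)
open import Data.Product.Properties using (≡-dec)
open import Data.Sum using (_⊎_; inj₁; inj₂; [_,_]′) renaming (swap to ⊎-swap)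
open import Data.List using (List; []; _∷_; [_]; _++_; map; allFin; tabulate; filter; length)
open import Data.List.Properties using (map-tabulate; map-++; map-∘; map-cong; map-id; ++-assoc)
open import Data.List.Relation.Unary.All using (All; []; _∷_)
import Data.List.Relation.Unary.All as All
import Data.List.Relation.Unary.All.Properties as All
open import Data.List.Relation.Unary.Unique.Propositional using (Unique)
import Data.List.Relation.Unary.Unique.Propositional.Properties as Unique
open import Data.List.Relation.Unary.AllPairs using (_∷_)
open import Data.List.Relation.Unary.Any using (Any; here; there)
import Data.List.Relation.Unary.Any as Any
open import Data.List.Membership.Propositional using (_∈_)
open import Data.List.Membership.Propositional.Properties
  using (∈-map⁻; ∈-∃++; ∈-allFin; ∈-filter⁺; ∈-filter⁻)
open import Data.List.Relation.Binary.Permutation.Propositional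
  using (_↭_; ↭-refl; ↭-sym; ↭-trans; ↭-reflexive; prep; swap; module PermutationReasoning)
open import Data.List.Relation.Binary.Permutation.Propositional.Properties
  using (map⁺; ∈-resp-↭; shift; shifts; ++-comm; ++⁺ʳ; drop-∷; ↭-empty-inv)
open import Data.Nat.ListAction.Properties using (sum-↭; sum-++)
open import Function using (_∘_; case_of_)
open import Relation.Binary.PropositionalEquality hiding ([_])
open import Relation.Nullary using (does; ¬_; yes; no; Dec)
open import Relation.Nullary.Decidable using (_⊎-dec_; _×-dec_; _→-dec_; ¬?; dec-true; dec-false)
open import Relation.Unary using (Decidable)
open import Data.Empty using (⊥; ⊥-elim)

-- Booleans and finite sums

does-true : ∀ {P : Set} (P? : Dec P) → does P? ≡ true → P
does-true (yes p) _ = p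

∧-true : ∀ {x y} → x ∧ y ≡ true → x ≡ true × y ≡ true
∧-true {true} {true} _ = refl , refl

∨-true : ∀ {x y} → x ∨ y ≡ true → x ≡ true ⊎ y ≡ true
∨-true {true}          _ = inj₁ refl
∨-true {false} {true}  _ = inj₂ refl

ind : Bool → ℕ
ind b = if b then 1 else 0

ind≤1 : ∀ b → ind b ≤ 1
ind≤1 false = z≤n
ind≤1 true  = ≤-refl

ind-∧-≤ : ∀ x y → ind (x ∧ y) ≤ ind x
ind-∧-≤ false y     = z≤n
ind-∧-≤ true  false = z≤n
ind-∧-≤ true  true  = ≤-refl

odd : ℕ → Bool
odd zero    = false
odd (suc n) = not (odd n)

odd-+ : ∀ m n → odd (m + n) ≡ odd m xor odd n
odd-+ zero    n = refl
odd-+ (suc m) n = trans (cong not (odd-+ m n)) (not-distribˡ-xor (odd m) (odd n))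

odd-ind : ∀ b → odd (ind b) ≡ b
odd-ind false = refl
odd-ind true  = refl

3≤even⇒4≤ : ∀ {c} → 3 ≤ c → odd c ≡ false → 4 ≤ c
3≤even⇒4≤ {suc (suc zero)}          (s≤s (s≤s ())) _
3≤even⇒4≤ {suc (suc (suc zero))}    _ ()
3≤even⇒4≤ {suc (suc (suc (suc c)))} _ _ = s≤s (s≤s (s≤s (s≤s z≤n)))

xor-telescope : ∀ p q r → (p xor q) xor (q xor r) ≡ p xor r
xor-telescope p q r = begin
  (p xor q) xor (q xor r) ≡⟨ xor-assoc p q (q xor r) ⟩
  p xor (q xor (q xor r)) ≡⟨ cong (p xor_) (xor-assoc q q r) ⟨
  p xor ((q xor q) xor r) ≡⟨ cong (λ z → p xor (z xor r)) (xor-same q) ⟩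
  p xor r                 ∎
  where open ≡-Reasoning

submodular-bits : ∀ x y x′ y′ →
  ind ((x ∧ y) xor (x′ ∧ y′)) + ind ((x ∨ y) xor (x′ ∨ y′)) ≤ ind (x xor x′) + ind (y xor y′)
submodular-bits false y false y′ = ≤-refl
submodular-bits true  y true  y′ = ≤-reflexive (+-identityʳ _)
submodular-bits false false true false = ≤ᵇ⇒≤ _ _ _
submodular-bits false false true true  = ≤ᵇ⇒≤ _ _ _
submodular-bits false true  true false = ≤ᵇ⇒≤ _ _ _
submodular-bits false true  true true  = ≤ᵇ⇒≤ _ _ _
submodular-bits true false false false = ≤ᵇ⇒≤ _ _ _
submodular-bits true false false true  = ≤ᵇ⇒≤ _ _ _
submodular-bits true true  false false = ≤ᵇ⇒≤ _ _ _
submodular-bits true true  false true  = ≤ᵇ⇒≤ _ _ _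

posimodular-bits : ∀ x y x′ y′ →
  ind ((x ∧ not y) xor (x′ ∧ not y′)) + ind ((y ∧ not x) xor (y′ ∧ not x′)) ≤ ind (x xor x′) + ind (y xor y′)
posimodular-bits false false false false = ≤ᵇ⇒≤ _ _ _
posimodular-bits false false false true  = ≤ᵇ⇒≤ _ _ _
posimodular-bits false false true  false = ≤ᵇ⇒≤ _ _ _
posimodular-bits false false true  true  = ≤ᵇ⇒≤ _ _ _
posimodular-bits false true  false false = ≤ᵇ⇒≤ _ _ _
posimodular-bits false true  false true  = ≤ᵇ⇒≤ _ _ _
posimodular-bits false true  true  false = ≤ᵇ⇒≤ _ _ _
posimodular-bits false true  true  true  = ≤ᵇ⇒≤ _ _ _
posimodular-bits true  false false false = ≤ᵇ⇒≤ _ _ _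
posimodular-bits true  false false true  = ≤ᵇ⇒≤ _ _ _
posimodular-bits true  false true  false = ≤ᵇ⇒≤ _ _ _
posimodular-bits true  false true  true  = ≤ᵇ⇒≤ _ _ _
posimodular-bits true  true  false false = ≤ᵇ⇒≤ _ _ _
posimodular-bits true  true  false true  = ≤ᵇ⇒≤ _ _ _
posimodular-bits true  true  true  false = ≤ᵇ⇒≤ _ _ _
posimodular-bits true  true  true  true  = ≤ᵇ⇒≤ _ _ _

xor-split-bits : ∀ x y → ind (x xor y) ≡ ind ((x ∧ y) xor y) + ind ((x ∧ y) xor x)
xor-split-bits false false = refl
xor-split-bits false true  = refl
xor-split-bits true  false = refl
xor-split-bits true  true  = refl

sum-mono-≤ : ∀ {k} {f g : Fin k → ℕ} → (∀ i → f i ≤ g i) → sum f ≤ sum g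
sum-mono-≤ {zero}  f≤g = z≤n
sum-mono-≤ {suc k} f≤g = +-mono-≤ (f≤g zero) (sum-mono-≤ (f≤g ∘ suc))

sum-<⇒∃< : ∀ {k} (f g : Fin k → ℕ) → sum f < sum g → ∃ λ i → f i < g i
sum-<⇒∃< {k} f g Σf<Σg with ¬∀⟶∃¬ k (λ i → g i ≤ f i) (λ i → g i ≤? f i) (<⇒≱ Σf<Σg ∘ sum-mono-≤)
... | i , gᵢ≰fᵢ = i , ≰⇒> gᵢ≰fᵢ

sum-<-at : ∀ {k} {f g : Fin k → ℕ} → (∀ i → f i ≤ g i) → ∀ i → f i < g i → sum f < sum g
sum-<-at {suc k} {f} {g} f≤g i fᵢ<gᵢ = subst₂ _<_ (sym (sum-remove f)) (sym (sum-remove g))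
  (+-mono-<-≤ fᵢ<gᵢ (sum-mono-≤ (f≤g ∘ punchIn i)))

sum-bump : ∀ {k} (f g : Fin k → ℕ) (i : Fin k) {c : ℕ} →
           (∀ j → j ≢ i → f j ≡ g j) → f i ≡ c + g i → sum f ≡ c + sum g
sum-bump {suc k} f g i {c} agree fᵢ = begin
  sum f                         ≡⟨ sum-remove f ⟩
  f i + sum (f ∘ punchIn i)     ≡⟨ cong₂ _+_ fᵢ (sum-cong-≗ λ j → agree (punchIn i j) (punchInᵢ≢i i j)) ⟩
  c + g i + sum (g ∘ punchIn i) ≡⟨ +-assoc c (g i) _ ⟩
  c + (g i + sum (g ∘ punchIn i)) ≡⟨ cong (c +_) (sum-remove g) ⟨
  c + sum g                     ∎
  where open ≡-Reasoning

listSum-tabulate : ∀ {k} (f : Fin k → ℕ) → List.sum (tabulate f) ≡ sum f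
listSum-tabulate {zero}  f = refl
listSum-tabulate {suc k} f = cong (f zero +_) (listSum-tabulate (f ∘ suc))

listSum-allFin : ∀ {k} (f : Fin k → ℕ) → List.sum (map f (allFin k)) ≡ sum f
listSum-allFin f = trans (cong List.sum (map-tabulate (λ i → i) f)) (listSum-tabulate f)

length-filter≡sum : ∀ {A : Set} (p : A → Bool) xs →
                    length (filter (λ x → p x ≟ᵇ true) xs) ≡ List.sum (map (ind ∘ p) xs)
length-filter≡sum p []       = refl
length-filter≡sum p (x ∷ xs) with p x
... | true  = cong suc (length-filter≡sum p xs)
... | false = length-filter≡sum p xs

anyBoolFun? : ∀ {N} {P : (Fin N → Bool) → Set} → (∀ {X Y} → (∀ v → X v ≡ Y v) → P X → P Y) →
              (∀ X → Dec (P X)) → Dec (∃ P)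
anyBoolFun? resp P? with anySubset? (λ s → P? (Vec.lookup s))
... | yes (s , p) = yes (Vec.lookup s , p)
... | no ¬p       = no λ (X , p) → ¬p (Vec.tabulate X , resp (λ v → sym (Vec.lookup∘tabulate X v)) p)

-- Cuts

module _ {N : ℕ} where

  _∩_ _∪_ _∖_ : (Fin N → Bool) → (Fin N → Bool) → Fin N → Bool
  (X ∩ Y) v = X v ∧ Y v
  (X ∪ Y) v = X v ∨ Y v
  (X ∖ Y) v = X v ∧ not (Y v)

  ⁅_⁆ : Fin N → Fin N → Bool
  ⁅ a ⁆ v = does (v ≟ a)

  crosses : (Fin N → Bool) → Fin N × Fin N → ℕ
  crosses X (u , v) = ind (X u xor X v)

  crosses-flip : ∀ X u v → crosses X (v , u) ≡ crosses X (u , v)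
  crosses-flip X u v = cong ind (xor-comm (X v) (X u))

crosses-∖⁅⁆-< : ∀ {N} (X : Fin N → Bool) a → X a ≡ true → ∀ u w →
  crosses X (u , w) < crosses (X ∖ ⁅ a ⁆) (u , w) →
  ∃ λ a′ → a′ ≢ a × X a′ ≡ true × ((u , w) ≡ (a , a′) ⊎ (u , w) ≡ (a′ , a))
crosses-∖⁅⁆-< X a Xa u w gain with u ≟ a | w ≟ a
... | yes refl | yes refl rewrite Xa = case gain of λ ()
... | yes refl | no w≢a with X w in Xw
...   | true  = w , w≢a , Xw , inj₁ refl
...   | false rewrite Xa = case gain of λ ()
crosses-∖⁅⁆-< X a Xa u w gain | no u≢a | yes refl with X u in Xu
...   | true  = u , u≢a , Xu , inj₂ refl
...   | false rewrite Xa = case gain of λ ()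
crosses-∖⁅⁆-< X a Xa u w gain | no _ | no _ =
  ⊥-elim (<-irrefl (sym (cong ind (cong₂ _xor_ (∧-identityʳ (X u)) (∧-identityʳ (X w))))) gain)

crosses-⁅⁆->0 : ∀ {N} (a u w : Fin N) → 0 < crosses ⁅ a ⁆ (u , w) →
                 ∃ λ a′ → a′ ≢ a × ((u , w) ≡ (a , a′) ⊎ (u , w) ≡ (a′ , a))
crosses-⁅⁆->0 a u w pos with u ≟ a | w ≟ a
... | yes refl | no w≢a   = w , w≢a , inj₁ refl
... | no u≢a   | yes refl = u , u≢a , inj₂ refl
... | yes refl | yes refl = case pos of λ ()
... | no _     | no _     = case pos of λ ()

Joins : (G : Graph) → Fin (m G) → Fin (n G) → Fin (n G) → Set
Joins G e u v = ends G e ≡ (u , v) ⊎ ends G e ≡ (v , u)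

Within : (G : Graph) → (Fin (n G) → Bool) → Set
Within G X = ∀ v → X v ≡ true → IsVertex G v

∁ : (G : Graph) → (Fin (n G) → Bool) → Fin (n G) → Bool
∁ G X v = present G v ∧ not (X v)

cut : (G : Graph) → (Fin (n G) → Bool) → ℕ
cut G X = sum (λ e → crosses X (ends G e))

module _ (G : Graph) where

  cutSize≡cut : ∀ X → cutSize G X ≡ cut G X
  cutSize≡cut X = listSum-allFin (λ e → crosses X (ends G e))

  crosses-sum-≤ : ∀ X′ Y′ X Y → (∀ p → crosses X′ p + crosses Y′ p ≤ crosses X p + crosses Y p) →
                  cut G X′ + cut G Y′ ≤ cut G X + cut G Y
  crosses-sum-≤ X′ Y′ X Y ≤ₚ = subst₂ _≤_ (∑-distrib-+ (cross X′) (cross Y′)) (∑-distrib-+ (cross X) (cross Y))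
    (sum-mono-≤ (≤ₚ ∘ ends G))
    where
    cross : (Fin (n G) → Bool) → Fin (m G) → ℕ
    cross Z e = crosses Z (ends G e)

  cut-submodular : ∀ X Y → cut G (X ∩ Y) + cut G (X ∪ Y) ≤ cut G X + cut G Y
  cut-submodular X Y = crosses-sum-≤ (X ∩ Y) (X ∪ Y) X Y λ (u , v) → submodular-bits (X u) (Y u) (X v) (Y v)

  cut-posimodular : ∀ X Y → cut G (X ∖ Y) + cut G (Y ∖ X) ≤ cut G X + cut G Y
  cut-posimodular X Y = crosses-sum-≤ (X ∖ Y) (Y ∖ X) X Y λ (u , v) → posimodular-bits (X u) (Y u) (X v) (Y v)

  cut-≗ : ∀ {X Y} → (∀ v → X v ≡ Y v) → cut G X ≡ cut G Y
  cut-≗ X≗Y = sum-cong-≗ λ e → cong₂ (λ x y → ind (x xor y)) (X≗Y (proj₁ (ends G e))) (X≗Y (proj₂ (ends G e)))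

  cut-cong : WellFormed G → ∀ {X Y} → (∀ v → IsVertex G v → X v ≡ Y v) → cut G X ≡ cut G Y
  cut-cong wf X≐Y = sum-cong-≗ λ e →
    cong₂ (λ x y → ind (x xor y)) (X≐Y _ (proj₁ (wf e))) (X≐Y _ (proj₂ (wf e)))

  cut-∁ : WellFormed G → ∀ X → cut G (∁ G X) ≡ cut G X
  cut-∁ wf X = sum-cong-≗ λ e → not-bits (wf e)
    where
    not-bits : ∀ {u v} → IsVertex G u × IsVertex G v → crosses (∁ G X) (u , v) ≡ crosses X (u , v)
    not-bits {u} {v} (pᵤ , pᵥ) rewrite pᵤ | pᵥ with X u | X v
    ... | false | false = refl
    ... | false | true  = refl
    ... | true  | false = refl
    ... | true  | true  = refl

cut-deleteEdge : ∀ G e X → cut G X ≡ crosses X (ends G e) + cut (deleteEdge G e) X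
cut-deleteEdge G@(graph _ (suc _) _ _) e X = sum-remove {i = e} (λ f → crosses X (ends G f))

crosses-joins : ∀ G {e u v} X → Joins G e u v → crosses X (ends G e) ≡ crosses X (u , v)
crosses-joins G X (inj₁ e≡) = cong (crosses X) e≡
crosses-joins G X (inj₂ e≡) = trans (cong (crosses X) e≡) (crosses-flip X _ _)

joins-vertex : ∀ G {e u v} → WellFormed G → Joins G e u v → IsVertex G v
joins-vertex G {e} wf (inj₁ e≡) = subst (IsVertex G) (cong proj₂ e≡) (proj₂ (wf e))
joins-vertex G {e} wf (inj₂ e≡) = subst (IsVertex G) (cong proj₁ e≡) (proj₁ (wf e))

cut-⁅⁆≥3 : ∀ G {a w} → ThreeEdgeConnected G → IsVertex G a → IsVertex G w → w ≢ a → 3 ≤ cut G ⁅ a ⁆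
cut-⁅⁆≥3 G {a} {w} tec pa pw w≢a =
  subst (3 ≤_) (cutSize≡cut G ⁅ a ⁆) (tec ⁅ a ⁆ within (a , dec-true (a ≟ a) refl) (w , pw , dec-false (w ≟ a) w≢a))
  where
  within : Within G ⁅ a ⁆
  within v v≡a = subst (IsVertex G) (sym (does-true (v ≟ a) v≡a)) pa

-- Walks and trails

module Trails (G : Graph) where

  Step : Set
  Step = Fin (m G) × Bool

  crossing : (Fin (n G) → Bool) → Step → ℕ
  crossing X s = crosses X (ends G (proj₁ s))

  crossing-tail-head : ∀ X s → crossing X s ≡ ind (X (tailO G s) xor X (headO G s))
  crossing-tail-head X (e , false) = refl
  crossing-tail-head X (e , true)  = crosses-flip X _ _

  crossings : (Fin (n G) → Bool) → List Step → ℕ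
  crossings X t = List.sum (map (crossing X) t)

  crossings-++ : ∀ X t t′ → crossings X (t ++ t′) ≡ crossings X t + crossings X t′
  crossings-++ X t t′ = trans (cong List.sum (map-++ (crossing X) t t′)) (sum-++ (map (crossing X) t) _)

  crossings-zero : ∀ X {t} → All (λ s → X (tailO G s) ≡ X (headO G s)) t → crossings X t ≡ 0
  crossings-zero X [] = refl
  crossings-zero X {s ∷ t} (same ∷ sames) = cong₂ _+_ crossing-zero (crossings-zero X sames)
    where
    crossing-zero : crossing X s ≡ 0
    crossing-zero = trans (crossing-tail-head X s)
                          (cong ind (trans (cong (_xor X (headO G s)) same) (xor-same (X (headO G s)))))

  cut≡crossings : ∀ X {t} → map proj₁ t ↭ allFin (m G) → cut G X ≡ crossings X t
  cut≡crossings X {t} t↭E = begin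
    cut G X                                      ≡⟨ cutSize≡cut G X ⟨
    List.sum (map (crossing X ∘ (_, false)) (allFin (m G))) ≡⟨ sum-↭ (map⁺ (crossing X ∘ (_, false)) (↭-sym t↭E)) ⟩
    List.sum (map (crossing X ∘ (_, false)) (map proj₁ t))  ≡⟨ cong List.sum (map-∘ t) ⟨
    crossings X t                                ∎
    where open ≡-Reasoning

  odd-crossings : ∀ X {x t y} → WalkFromTo G x t y → odd (crossings X t) ≡ X x xor X y
  odd-crossings X {x} {[]} refl = sym (xor-same (X x))
  odd-crossings X {t = s ∷ t} {y} (refl , w) = begin
    odd (crossing X s + crossings X t)                     ≡⟨ odd-+ (crossing X s) _ ⟩
    odd (crossing X s) xor odd (crossings X t)             ≡⟨ cong₂ _xor_ odd-step (odd-crossings X w) ⟩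
    (X (tailO G s) xor X (headO G s)) xor (X (headO G s) xor X y)
      ≡⟨ xor-telescope (X (tailO G s)) (X (headO G s)) (X y) ⟩
    X (tailO G s) xor X y                                  ∎
    where
    open ≡-Reasoning
    odd-step : odd (crossing X s) ≡ X (tailO G s) xor X (headO G s)
    odd-step = trans (cong odd (crossing-tail-head X s)) (odd-ind _)

  walk-++ : ∀ {x t y t′ z} → WalkFromTo G x t y → WalkFromTo G y t′ z → WalkFromTo G x (t ++ t′) z
  walk-++ {t = []}    refl     w′ = w′
  walk-++ {t = s ∷ t} (tₛ , w) w′ = tₛ , walk-++ w w′

  walk-split : ∀ {x} t {t′ z} → WalkFromTo G x (t ++ t′) z →
               ∃ λ y → WalkFromTo G x t y × WalkFromTo G y t′ z
  walk-split []      w        = _ , refl , w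
  walk-split (s ∷ t) (tₛ , w) with walk-split t w
  ... | y , w₁ , w₂ = y , (tₛ , w₁) , w₂

  reverseStep : Step → Step
  reverseStep (e , o) = e , not o

  reverseStep-walk : ∀ s → WalkFromTo G (headO G s) [ reverseStep s ] (tailO G s)
  reverseStep-walk (e , false) = refl , refl
  reverseStep-walk (e , true)  = refl , refl

  backwards : List Step → List Step
  backwards []      = []
  backwards (s ∷ t) = backwards t ++ [ reverseStep s ]

  walk-backwards : ∀ {x t y} → WalkFromTo G x t y → WalkFromTo G y (backwards t) x
  walk-backwards {t = []}    refl     = refl
  walk-backwards {t = s ∷ t} (refl , w) = walk-++ (walk-backwards w) (reverseStep-walk s)

  backwards-edges : ∀ t → map proj₁ (backwards t) ↭ map proj₁ t
  backwards-edges []      = ↭-refl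
  backwards-edges (s ∷ t) = begin
    map proj₁ (backwards t ++ [ reverseStep s ]) ≡⟨ map-++ proj₁ (backwards t) _ ⟩
    map proj₁ (backwards t) ++ [ proj₁ s ]       ↭⟨ ++-comm (map proj₁ (backwards t)) _ ⟩
    proj₁ s ∷ map proj₁ (backwards t)            ↭⟨ prep (proj₁ s) (backwards-edges t) ⟩
    proj₁ s ∷ map proj₁ t                        ∎
    where open PermutationReasoning

  heads-from-tails : ∀ (P : Fin (n G) → Set) {x t y} → WalkFromTo G x t y →
                     All (P ∘ tailO G) t → P y → All (P ∘ headO G) t
  heads-from-tails P {t = []}          _            []       _  = []
  heads-from-tails P {t = s ∷ []}      (_ , refl)   _        py = py ∷ []
  heads-from-tails P {t = s ∷ s′ ∷ t}  (_ , tₛ′ , w) (_ ∷ ps) py =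
    subst P tₛ′ (All.head ps) ∷ heads-from-tails P (tₛ′ , w) ps py

  data Visit (Q : Fin (n G) → Set) (x : Fin (n G)) (t : List Step) (y : Fin (n G)) : Set where
    visits : ∀ t₁ t₂ {v} → t ≡ t₁ ++ t₂ → WalkFromTo G x t₁ v → WalkFromTo G v t₂ y → Q v → Visit Q x t y
    avoids : All (λ s → ¬ Q (tailO G s)) t → ¬ Q y → Visit Q x t y

  visit? : ∀ {Q} → Decidable Q → ∀ {x t y} → WalkFromTo G x t y → Visit Q x t y
  visit? {Q} Q? {x} w with Q? x
  ... | yes q = visits [] _ refl refl w q
  visit? Q? {t = []}    refl     | no ¬q = avoids [] ¬q
  visit? Q? {t = s ∷ t} (tₛ , w) | no ¬q with visit? Q? w
  ... | visits t₁ t₂ t≡ w₁ w₂ q = visits (s ∷ t₁) t₂ (cong (s ∷_) t≡) (tₛ , w₁) w₂ q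
  ... | avoids ¬qs ¬qy         = avoids ((λ q → ¬q (subst _ tₛ q)) ∷ ¬qs) ¬qy

  Visited : Fin (n G) → List Step → Fin (n G) → Set
  Visited x t v = v ≡ x ⊎ Any (λ s → tailO G s ≡ v) t

  visited? : ∀ x t → Decidable (Visited x t)
  visited? x t v = (v ≟ x) ⊎-dec Any.any? (λ s → tailO G s ≟ v) t

  walk-split-at : ∀ {x t y v} → WalkFromTo G x t y → Visited x t v →
                  ∃ λ t₁ → ∃ λ t₂ → t ≡ t₁ ++ t₂ × WalkFromTo G x t₁ v × WalkFromTo G v t₂ y
  walk-split-at w (inj₁ refl) = [] , _ , refl , refl , w
  walk-split-at {t = s ∷ t} (tₛ , w) (inj₂ (here tₛ≡v)) = [] , s ∷ t , refl , trans (sym tₛ) tₛ≡v , tₛ≡v , w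
  walk-split-at {t = s ∷ t} (tₛ , w) (inj₂ (there v∈t)) with walk-split-at w (inj₂ v∈t)
  ... | t₁ , t₂ , t≡ , w₁ , w₂ = s ∷ t₁ , t₂ , cong (s ∷_) t≡ , (tₛ , w₁) , w₂

  start-from-tails : ∀ (P : Fin (n G) → Set) {x t y} → WalkFromTo G x t y → All (P ∘ tailO G) t → P y → P x
  start-from-tails P {t = []}    refl     _       py = py
  start-from-tails P {t = s ∷ t} (tₛ , _) (p ∷ _) _  = subst P tₛ p

  orient : ∀ {u v} s → Joins G (proj₁ s) u v →
           (tailO G s ≡ u × headO G s ≡ v) ⊎ (tailO G s ≡ v × headO G s ≡ u)
  orient (e , false) (inj₁ eq) = inj₁ (cong proj₁ eq , cong proj₂ eq)
  orient (e , true)  (inj₁ eq) = inj₂ (cong proj₂ eq , cong proj₁ eq)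
  orient (e , false) (inj₂ eq) = inj₂ (cong proj₁ eq , cong proj₂ eq)
  orient (e , true)  (inj₂ eq) = inj₁ (cong proj₂ eq , cong proj₁ eq)

  tail-vertex : WellFormed G → ∀ s → IsVertex G (tailO G s)
  tail-vertex wf (e , false) = proj₁ (wf e)
  tail-vertex wf (e , true)  = proj₂ (wf e)

  data Through (e : Fin (m G)) (x y : Fin (n G)) : Set where
    through : ∀ A s B → proj₁ s ≡ e → WalkFromTo G x A (tailO G s) → WalkFromTo G (headO G s) B y →
              e ∷ map proj₁ (A ++ B) ↭ allFin (m G) → Through e x y

  trail-through : ∀ {x y} → HasEulerianTrail G x y → ∀ e → Through e x y
  trail-through (T , w , T↭E) e with ∈-map⁻ proj₁ (∈-resp-↭ (↭-sym T↭E) (∈-allFin e))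
  ... | s , s∈T , refl with ∈-∃++ s∈T
  ... | A , B , refl with walk-split A w
  ... | _ , wA , (refl , wB) = through A s B refl wA wB (begin
    proj₁ s ∷ map proj₁ (A ++ B)              ≡⟨ cong (proj₁ s ∷_) (map-++ proj₁ A B) ⟩
    proj₁ s ∷ map proj₁ A ++ map proj₁ B      ↭⟨ shift (proj₁ s) (map proj₁ A) (map proj₁ B) ⟨
    map proj₁ A ++ [ proj₁ s ] ++ map proj₁ B ≡⟨ map-++ proj₁ A (s ∷ B) ⟨
    map proj₁ (A ++ s ∷ B)                    ↭⟨ T↭E ⟩
    allFin (m G)                              ∎)
    where open PermutationReasoning

  -- An Eulerian trail of G − e, its edges still numbered as in G.
  TrailWithout : Fin (m G) → Fin (n G) → Fin (n G) → Set
  TrailWithout e x y = ∃ λ t → WalkFromTo G x t y × (e ∷ map proj₁ t ↭ allFin (m G))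

  trail-without-loop : ∀ {x y e u} → HasEulerianTrail G x y → ends G e ≡ (u , u) → TrailWithout e x y
  trail-without-loop {e = e} T loop with trail-through T e
  ... | through A s B refl wA wB A++B↭E = A ++ B , walk-++ wA (subst (λ z → WalkFromTo G z B _) turn wB) , A++B↭E
    where
    turn : headO G s ≡ tailO G s
    turn with orient s (inj₁ loop)
    ... | inj₁ (tₛ , hₛ) = trans hₛ (sym tₛ)
    ... | inj₂ (tₛ , hₛ) = trans hₛ (sym tₛ)

  private
    rotate : ∀ {X : Set} (b₁ a₂ a₁ b₂ : List X) → b₁ ++ a₂ ++ a₁ ++ b₂ ↭ (a₁ ++ a₂) ++ b₁ ++ b₂
    rotate b₁ a₂ a₁ b₂ = begin
      b₁ ++ a₂ ++ a₁ ++ b₂   ≡⟨ cong (b₁ ++_) (++-assoc a₂ a₁ b₂) ⟨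
      b₁ ++ (a₂ ++ a₁) ++ b₂ ↭⟨ shifts b₁ (a₂ ++ a₁) ⟩
      (a₂ ++ a₁) ++ b₁ ++ b₂ ↭⟨ ++⁺ʳ (b₁ ++ b₂) (++-comm a₂ a₁) ⟩
      (a₁ ++ a₂) ++ b₁ ++ b₂ ∎
      where open PermutationReasoning

  splice : WellFormed G → ThreeEdgeConnected G → ∀ {x y A s B} → IsVertex G x → IsVertex G y →
           WalkFromTo G x A x → tailO G s ≡ x → WalkFromTo G (headO G s) B y →
           proj₁ s ∷ map proj₁ (A ++ B) ↭ allFin (m G) → TrailWithout (proj₁ s) (headO G s) y
  splice wf tec {x} {y} {A} {s} {B} px py wA tₛ wB A++B↭E with visit? (visited? x A) wB
  ... | visits B₁ B₂ refl wB₁ wB₂ v∈A with walk-split-at wA v∈A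
  ...   | A₁ , A₂ , refl , wA₁ , wA₂ =
    B₁ ++ A₂ ++ A₁ ++ B₂ , walk-++ wB₁ (walk-++ wA₂ (walk-++ wA₁ wB₂)) ,
    ↭-trans (prep (proj₁ s) (map⁺ proj₁ (rotate B₁ A₂ A₁ B₂))) A++B↭E
  splice wf tec {x} {y} {A} {s} {B} px py wA tₛ wB A++B↭E | avoids B∌ y∉A =
    case subst (3 ≤_) (trans (cutSize≡cut G X) cut≡1) cut≥3 of λ { (s≤s ()) }
    where
    X : Fin (n G) → Bool
    X v = does (visited? x A v)
    in-X : ∀ {v} → Visited x A v → X v ≡ true
    in-X = dec-true (visited? x A _)
    out-X : ∀ {v} → ¬ Visited x A v → X v ≡ false
    out-X = dec-false (visited? x A _)
    within : Within G X
    within v Xv with does-true (visited? x A v) Xv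
    ... | inj₁ refl = px
    ... | inj₂ v∈A with Any.satisfied v∈A
    ...   | s′ , refl = tail-vertex wf s′
    cut≥3 : 3 ≤ cutSize G X
    cut≥3 = tec X within (x , in-X (inj₁ refl)) (y , py , out-X y∉A)
    A-tails : All (Visited x A ∘ tailO G) A
    A-tails = All.tabulate λ s′∈A → inj₂ (Any.map (λ eq → cong (tailO G) (sym eq)) s′∈A)
    A-inside : crossings X A ≡ 0
    A-inside = crossings-zero X (All.zipWith (λ (t , h) → trans (in-X t) (sym (in-X h)))
      (A-tails , heads-from-tails (Visited x A) wA A-tails (inj₁ refl)))
    B-outside : crossings X B ≡ 0
    B-outside = crossings-zero X (All.zipWith (λ (t , h) → trans (out-X t) (sym (out-X h)))
      (B∌ , heads-from-tails (λ v → ¬ Visited x A v) wB B∌ y∉A))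
    s-crosses : crossing X s ≡ 1
    s-crosses = trans (crossing-tail-head X s) (cong₂ (λ p q → ind (p xor q))
      (trans (cong X tₛ) (in-X (inj₁ refl))) (out-X (start-from-tails (λ v → ¬ Visited x A v) wB B∌ y∉A)))
    cut≡1 : cut G X ≡ 1
    cut≡1 = begin
      cut G X                                     ≡⟨ cut≡crossings X {s ∷ A ++ B} A++B↭E ⟩
      crossing X s + crossings X (A ++ B)         ≡⟨ cong (crossing X s +_) (crossings-++ X A B) ⟩
      crossing X s + (crossings X A + crossings X B) ≡⟨ cong₂ (λ c d → c + (d + crossings X B)) s-crosses A-inside ⟩
      1 + crossings X B                          ≡⟨ cong suc B-outside ⟩
      1                                           ∎
      where open ≡-Reasoning

  trail-without-edge : WellFormed G → ThreeEdgeConnected G → ∀ {x x′ y e} → IsVertex G x → IsVertex G y →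
                       Joins G e x x′ → HasEulerianTrail G x y → TrailWithout e x′ y
  trail-without-edge wf tec {e = e} px py joins T with trail-through T e
  ... | through A s B refl wA wB A++B↭E with orient s joins
  ...   | inj₁ (tₛ , refl) = splice wf tec {s = s} px py (subst (WalkFromTo G _ A) tₛ wA) tₛ wB A++B↭E
  ...   | inj₂ (refl , refl) =
    backwards A ++ B , walk-++ (walk-backwards wA) wB , ↭-trans (prep (proj₁ s) reversal) A++B↭E
    where
    open PermutationReasoning
    reversal : map proj₁ (backwards A ++ B) ↭ map proj₁ (A ++ B)
    reversal = begin
      map proj₁ (backwards A ++ B)             ≡⟨ map-++ proj₁ (backwards A) B ⟩
      map proj₁ (backwards A) ++ map proj₁ B   ↭⟨ ++⁺ʳ (map proj₁ B) (backwards-edges A) ⟩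
      map proj₁ A ++ map proj₁ B               ≡⟨ map-++ proj₁ A B ⟨
      map proj₁ (A ++ B)                       ∎

  walk-last : ∀ {x s t y} → WalkFromTo G x (s ∷ t) y →
              ∃ λ P → ∃ λ s′ → s ∷ t ≡ P ++ [ s′ ] × WalkFromTo G x P (tailO G s′) × headO G s′ ≡ y
  walk-last {t = []}            (tₛ , refl) = [] , _ , refl , sym tₛ , refl
  walk-last {s = s} {t = _ ∷ _} (tₛ , w)    with walk-last w
  ... | P , s′ , t≡ , wP , hₛ′ = s ∷ P , s′ , cong (s ∷_) t≡ , (tₛ , wP) , hₛ′

  data Passage (v x y : Fin (n G)) : Set where
    passage : ∀ P s₁ s₂ Q → WalkFromTo G x P (tailO G s₁) → headO G s₁ ≡ v → tailO G s₂ ≡ v →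
              WalkFromTo G (headO G s₂) Q y → map proj₁ (P ++ s₁ ∷ s₂ ∷ Q) ↭ allFin (m G) → Passage v x y

  trail-passes : ∀ {x y v f u} → HasEulerianTrail G x y → x ≢ v → y ≢ v → Joins G f v u → Passage v x y
  trail-passes {v = v} {f} (T , w , T↭E) x≢v y≢v joins with visit? (_≟ v) w
  ... | visits []      _        _    w₁ _  v′≡v = ⊥-elim (x≢v (trans w₁ v′≡v))
  ... | visits (_ ∷ _) []       _    _  w₂ v′≡v = ⊥-elim (y≢v (trans (sym w₂) v′≡v))
  ... | visits (s ∷ t) (s₂ ∷ Q) refl w₁ (tₛ₂ , wQ) refl with walk-last {s = s} {t = t} w₁
  ...   | P , s₁ , t≡ , wP , hₛ₁ = passage P s₁ s₂ Q wP hₛ₁ tₛ₂ wQ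
          (subst (λ T → map proj₁ T ↭ allFin (m G)) (trans (cong (_++ s₂ ∷ Q) t≡) (++-assoc P [ s₁ ] (s₂ ∷ Q))) T↭E)
  trail-passes {v = v} {f} (T , w , T↭E) x≢v y≢v joins | avoids tails≢v _
    with ∈-map⁻ proj₁ (∈-resp-↭ (↭-sym T↭E) (∈-allFin f))
  ... | s , s∈T , refl with orient s joins
  ...   | inj₁ (tₛ , _) = ⊥-elim (All.lookup tails≢v s∈T tₛ)
  ...   | inj₂ (_ , hₛ) = ⊥-elim (All.lookup (heads-from-tails (λ u → ¬ u ≡ v) w tails≢v y≢v) s∈T hₛ)

open Trails using (cut≡crossings; odd-crossings)

cut-parity : ∀ G {a b} → HasEulerianTrail G a b → ∀ X → odd (cut G X) ≡ X a xor X b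
cut-parity G (t , w , t↭E) X = trans (cong odd (cut≡crossings G X t↭E)) (odd-crossings G X w)

walk-relabel : ∀ {N mG mH prG prH} {EG : Fin mG → Fin N × Fin N} {EH : Fin mH → Fin N × Fin N}
               (f : Fin mG → Fin mH) {x t y} → WalkFromTo (graph N mG prG EG) x t y →
               All (λ s → EH (f (proj₁ s)) ≡ EG (proj₁ s)) t →
               WalkFromTo (graph N mH prH EH) x (map (map₁ f) t) y
walk-relabel f {t = []}          w        []          = w
walk-relabel {N} {mG} {mH} {prG} {prH} {EG} {EH} f {t = (g , o) ∷ t} (tₛ , w) (same ∷ ps) =
  trans (tail≡ o) tₛ , subst (λ z → WalkFromTo H z (map (map₁ f) t) _) (sym (head≡ o)) (walk-relabel f w ps)
  where
  G H : Graph
  G = graph N mG prG EG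
  H = graph N mH prH EH
  tail≡ : ∀ o → tailO H (f g , o) ≡ tailO G (g , o)
  tail≡ false = cong proj₁ same
  tail≡ true  = cong proj₂ same
  head≡ : ∀ o → headO H (f g , o) ≡ headO G (g , o)
  head≡ false = cong proj₂ same
  head≡ true  = cong proj₁ same

-- squeeze i is punchOut i away from i; its value at i itself is junk.
squeeze : ∀ {k} → Fin (suc (suc k)) → Fin (suc (suc k)) → Fin (suc k)
squeeze i j with i ≟ j
... | yes _   = zero
... | no i≢j  = punchOut i≢j

squeeze-punchIn : ∀ {k} (i : Fin (suc (suc k))) j → squeeze i (punchIn i j) ≡ j
squeeze-punchIn i j with i ≟ punchIn i j
... | yes i≡ = ⊥-elim (punchInᵢ≢i i j (sym i≡))
... | no _   = trans (punchOut-cong i refl) (punchOut-punchIn i)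

punchIn-squeeze : ∀ {k} (i : Fin (suc (suc k))) {j} → j ≢ i → punchIn i (squeeze i j) ≡ j
punchIn-squeeze i {j} j≢i with i ≟ j
... | yes i≡j = ⊥-elim (j≢i (sym i≡j))
... | no i≢j  = punchIn-punchOut i≢j

allFin-suc : ∀ k → allFin (suc k) ≡ zero ∷ map suc (allFin k)
allFin-suc k = cong (zero ∷_) (sym (map-tabulate (λ j → j) suc))

allFin-punchIn : ∀ k (i : Fin (suc k)) → allFin (suc k) ↭ i ∷ map (punchIn i) (allFin k)
allFin-punchIn k       zero    = ↭-reflexive (allFin-suc k)
allFin-punchIn (suc k) (suc i) = begin
  allFin (suc (suc k))                                ≡⟨ allFin-suc (suc k) ⟩
  zero ∷ map suc (allFin (suc k))                     ↭⟨ prep zero (map⁺ suc (allFin-punchIn k i)) ⟩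
  zero ∷ suc i ∷ map suc (map (punchIn i) (allFin k)) ↭⟨ swap zero (suc i) ↭-refl ⟩
  suc i ∷ zero ∷ map suc (map (punchIn i) (allFin k)) ≡⟨ cong (λ js → suc i ∷ zero ∷ js) (map-∘ (allFin k)) ⟨
  suc i ∷ zero ∷ map (suc ∘ punchIn i) (allFin k)     ≡⟨ cong (λ js → suc i ∷ zero ∷ js) (map-∘ (allFin k)) ⟩
  suc i ∷ map (punchIn (suc i)) (zero ∷ map suc (allFin k))
    ≡⟨ cong (λ js → suc i ∷ map (punchIn (suc i)) js) (allFin-suc k) ⟨
  suc i ∷ map (punchIn (suc i)) (allFin (suc k))      ∎
  where open PermutationReasoning

↭-allFin-tail : ∀ {k} {x : Fin (suc k)} {xs} → x ∷ xs ↭ allFin (suc k) → xs ↭ map (punchIn x) (allFin k)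
↭-allFin-tail {k} {x} x∷xs↭ = drop-∷ (↭-trans x∷xs↭ (allFin-punchIn k x))

↭-allFin-distinct : ∀ {k} {x : Fin (suc k)} {xs} → x ∷ xs ↭ allFin (suc k) → All (_≢ x) xs
↭-allFin-distinct {k} {x} x∷xs↭ = All.tabulate λ y∈xs → punched (∈-resp-↭ (↭-allFin-tail x∷xs↭) y∈xs)
  where
  punched : ∀ {y} → y ∈ map (punchIn x) (allFin k) → y ≢ x
  punched y∈ with ∈-map⁻ (punchIn x) y∈
  ... | j , _ , refl = punchInᵢ≢i x j

trail-deleteEdge : ∀ G {e x y} → Trails.TrailWithout G e x y → HasEulerianTrail (deleteEdge G e) x y
trail-deleteEdge (graph _ (suc zero) _ _) {zero} (t , w , t↭E) with ↭-empty-inv (drop-∷ t↭E)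
trail-deleteEdge (graph _ (suc zero) _ _) {zero} ([] , w , t↭E) | _ = [] , w , ↭-refl
trail-deleteEdge (graph N (suc (suc k)) pr E) {e} (t , w , t↭E) =
  map (map₁ (squeeze e)) t , walk-relabel {prH = pr} (squeeze e) w (All.map⁻ (All.map ends-kept avoids-e)) , edges
  where
  avoids-e : All (_≢ e) (map proj₁ t)
  avoids-e = ↭-allFin-distinct t↭E
  ends-kept : ∀ {g} → g ≢ e → E (punchIn e (squeeze e g)) ≡ E g
  ends-kept g≢e = cong E (punchIn-squeeze e g≢e)
  edges : map proj₁ (map (map₁ (squeeze e)) t) ↭ allFin (suc k)
  edges = begin
    map proj₁ (map (map₁ (squeeze e)) t)                   ≡⟨ map-∘ t ⟨
    map (squeeze e ∘ proj₁) t                              ≡⟨ map-∘ t ⟩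
    map (squeeze e) (map proj₁ t)                          ↭⟨ map⁺ (squeeze e) (↭-allFin-tail t↭E) ⟩
    map (squeeze e) (map (punchIn e) (allFin (suc k)))     ≡⟨ map-∘ (allFin (suc k)) ⟨
    map (squeeze e ∘ punchIn e) (allFin (suc k))           ≡⟨ map-cong (squeeze-punchIn e) (allFin (suc k)) ⟩
    map (λ j → j) (allFin (suc k))                         ≡⟨ map-id (allFin (suc k)) ⟩
    allFin (suc k)                                         ∎
    where open PermutationReasoning

-- Incidence and smoothing

incident : (G : Graph) → Fin (n G) → List (Fin (m G))
incident G v = filter (λ e → isIncident G v e ≟ᵇ true) (allFin (m G))

DegreeTwo : (G : Graph) → Fin (n G) → Fin (m G) → Fin (m G) → Set
DegreeTwo G v f₁ f₂ = incident G v ≡ f₁ ∷ f₂ ∷ [] × isLoop G f₁ ≡ false × isLoop G f₂ ≡ false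

Smoothable : (G : Graph) → Fin (n G) → Set
Smoothable G v = ∃ λ f₁ → ∃ λ f₂ → DegreeTwo G v f₁ f₂

graphOf : (G : Graph) → GraphData (n G) → Graph
graphOf G (present′ , m′ , ends′) = graph (n G) m′ present′ ends′

merge : (G : Graph) → Fin (n G) → Fin (m G) → Fin (m G) → Graph
merge G v f₁ f₂ = graphOf G (mergeAt G v f₁ f₂)

-- smooth G v unfolds to graphOf G (smoothWith G v (incident G v)).
smooth-elim : ∀ G v (P : GraphData (n G) → Set) → (¬ Smoothable G v → P (unchanged G)) →
              (∀ f₁ f₂ → DegreeTwo G v f₁ f₂ → P (mergeAt G v f₁ f₂)) → P (smoothWith G v (incident G v))
smooth-elim G v P keep merged = go (incident G v) refl
  where
  unsmoothable : ∀ {L} → incident G v ≡ L →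
                 (∀ f₁ f₂ → L ≡ f₁ ∷ f₂ ∷ [] → isLoop G f₁ ≡ false → isLoop G f₂ ≡ false → ⊥) →
                 ¬ Smoothable G v
  unsmoothable L≡ impossible (f₁ , f₂ , L≡′ , ℓ₁ , ℓ₂) = impossible f₁ f₂ (trans (sym L≡) L≡′) ℓ₁ ℓ₂
  go : ∀ L → incident G v ≡ L → P (smoothWith G v L)
  go []              L≡ = keep (unsmoothable L≡ λ _ _ ())
  go (_ ∷ [])        L≡ = keep (unsmoothable L≡ λ _ _ ())
  go (_ ∷ _ ∷ _ ∷ _) L≡ = keep (unsmoothable L≡ λ _ _ ())
  go (f₁ ∷ f₂ ∷ [])  L≡ with isLoop G f₁ in ℓ₁ | isLoop G f₂ in ℓ₂
  ... | false | false = merged f₁ f₂ (L≡ , ℓ₁ , ℓ₂)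
  ... | true  | _     = keep (unsmoothable L≡ λ { _ _ refl ℓ₁′ _ → case trans (sym ℓ₁) ℓ₁′ of λ () })
  ... | false | true  = keep (unsmoothable L≡ λ { _ _ refl _ ℓ₂′ → case trans (sym ℓ₂) ℓ₂′ of λ () })

Loopless : (G : Graph) → Fin (n G) → Set
Loopless G v = ∀ f → ends G f ≢ (v , v)

module Incidence (G : Graph) (v : Fin (n G)) where

  incident-∈ : ∀ {f} → f ∈ incident G v → isIncident G v f ≡ true
  incident-∈ f∈ = proj₂ (∈-filter⁻ (λ e → isIncident G v e ≟ᵇ true) {xs = allFin (m G)} f∈)

  ∈-incident : ∀ {f} → isIncident G v f ≡ true → f ∈ incident G v
  ∈-incident inc = ∈-filter⁺ (λ e → isIncident G v e ≟ᵇ true) (∈-allFin _) inc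

  loop-at : ∀ f → isIncident G v f ≡ true → isLoop G f ≡ true → ends G f ≡ (v , v)
  loop-at f = pair-loop (ends G f)
    where
    pair-loop : ∀ p → does (proj₁ p ≟ v) ∨ does (proj₂ p ≟ v) ≡ true → does (proj₁ p ≟ proj₂ p) ≡ true → p ≡ (v , v)
    pair-loop (u , w) inc loop with does-true (u ≟ w) loop
    ... | refl with u ≟ v | inc
    ...   | yes refl | _ = refl

  incident-nonloop : Loopless G v → ∀ {f} → f ∈ incident G v → isLoop G f ≡ false
  incident-nonloop loopless {f} f∈ with isLoop G f in ℓ
  ... | false = refl
  ... | true  = ⊥-elim (loopless f (loop-at f (incident-∈ f∈) ℓ))

  crosses-⁅⁆ : ∀ f → ends G f ≢ (v , v) → crosses ⁅ v ⁆ (ends G f) ≡ ind (isIncident G v f)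
  crosses-⁅⁆ f = pair-crosses (ends G f)
    where
    pair-crosses : ∀ p → p ≢ (v , v) → crosses ⁅ v ⁆ p ≡ ind (does (proj₁ p ≟ v) ∨ does (proj₂ p ≟ v))
    pair-crosses (u , w) p≢ with u ≟ v | w ≟ v
    ... | yes refl | yes refl = ⊥-elim (p≢ refl)
    ... | yes _    | no _     = refl
    ... | no _     | yes _    = refl
    ... | no _     | no _     = refl

  cut-⁅⁆≡degree : Loopless G v → cut G ⁅ v ⁆ ≡ length (incident G v)
  cut-⁅⁆≡degree loopless = begin
    cut G ⁅ v ⁆                                           ≡⟨ sum-cong-≗ (λ f → crosses-⁅⁆ f (loopless f)) ⟩
    sum (ind ∘ isIncident G v)                            ≡⟨ listSum-allFin (ind ∘ isIncident G v) ⟨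
    List.sum (map (ind ∘ isIncident G v) (allFin (m G))) ≡⟨ length-filter≡sum (isIncident G v) (allFin (m G)) ⟨
    length (incident G v)                                 ∎
    where open ≡-Reasoning

  loop-isLoop : ∀ {f} → ends G f ≡ (v , v) → isLoop G f ≡ true
  loop-isLoop loop rewrite loop = dec-true (v ≟ v) refl

  loop-incident : ∀ {f} → ends G f ≡ (v , v) → isIncident G v f ≡ true
  loop-incident loop rewrite loop = cong (_∨ does (v ≟ v)) (dec-true (v ≟ v) refl)

  degreeTwo-loopless : ∀ {f₁ f₂} → DegreeTwo G v f₁ f₂ → Loopless G v
  degreeTwo-loopless (L≡ , ℓ₁ , ℓ₂) f loop with subst (f ∈_) L≡ (∈-incident (loop-incident loop))
  ... | here refl         = case trans (sym ℓ₁) (loop-isLoop loop) of λ ()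
  ... | there (here refl) = case trans (sym ℓ₂) (loop-isLoop loop) of λ ()

  degreeTwo-cut : ∀ {f₁ f₂} → DegreeTwo G v f₁ f₂ → cut G ⁅ v ⁆ ≡ 2
  degreeTwo-cut d@(L≡ , _) = trans (cut-⁅⁆≡degree (degreeTwo-loopless d)) (cong length L≡)

  cut-⁅⁆≡2⇒smoothable : Loopless G v → cut G ⁅ v ⁆ ≡ 2 → Smoothable G v
  cut-⁅⁆≡2⇒smoothable loopless cut≡2 = two (incident G v) refl (trans (sym (cut-⁅⁆≡degree loopless)) cut≡2)
    where
    two : ∀ L → incident G v ≡ L → length L ≡ 2 → Smoothable G v
    two (f₁ ∷ f₂ ∷ []) L≡ _ = f₁ , f₂ , L≡ ,
      incident-nonloop loopless (subst (f₁ ∈_) (sym L≡) (here refl)) ,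
      incident-nonloop loopless (subst (f₂ ∈_) (sym L≡) (there (here refl)))

  otherEnd-joins : ∀ f → isIncident G v f ≡ true → isLoop G f ≡ false →
                   Joins G f v (otherEnd G v f) × otherEnd G v f ≢ v
  otherEnd-joins f = pair-other (ends G f) refl
    where
    pair-other : ∀ p → ends G f ≡ p → does (proj₁ p ≟ v) ∨ does (proj₂ p ≟ v) ≡ true →
                 does (proj₁ p ≟ proj₂ p) ≡ false → Joins G f v (otherEnd G v f) × otherEnd G v f ≢ v
    pair-other (u , w) ends≡ rewrite ends≡ with u ≟ v | w ≟ v
    ... | yes refl | yes refl = λ _ nonloop → case trans (sym nonloop) (dec-true (u ≟ u) refl) of λ ()
    ... | yes refl | no w≢v   = λ _ _ → inj₁ refl , w≢v
    ... | no u≢v   | yes refl = λ _ _ → inj₂ refl , u≢v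

  step-incident : ∀ s → tailO G s ≡ v ⊎ headO G s ≡ v → isIncident G v (proj₁ s) ≡ true
  step-incident (g , false) (inj₁ tₛ) = cong (_∨ does (proj₂ (ends G g) ≟ v)) (dec-true (_ ≟ v) tₛ)
  step-incident (g , true)  (inj₂ hₛ) = cong (_∨ does (proj₂ (ends G g) ≟ v)) (dec-true (_ ≟ v) hₛ)
  step-incident (g , false) (inj₂ hₛ) = trans (cong (does (proj₁ (ends G g) ≟ v) ∨_) (dec-true (_ ≟ v) hₛ)) (∨-zeroʳ _)
  step-incident (g , true)  (inj₁ tₛ) = trans (cong (does (proj₁ (ends G g) ≟ v) ∨_) (dec-true (_ ≟ v) tₛ)) (∨-zeroʳ _)

-- Tight sets

Tight : (G : Graph) → Fin (n G) → (Fin (n G) → Bool) → Set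
Tight G a X = Within G X × X a ≡ true × cut G X ≡ 3 × ∃ λ v → v ≢ a × X v ≡ true

module TightSets (G : Graph) (a b : Fin (n G)) (pb : IsVertex G b) (tec : ThreeEdgeConnected G)
                 (parity : ∀ X → odd (cut G X) ≡ X a xor X b) where

  cut≥3 : ∀ {X} → Within G X → ∀ {v w} → X v ≡ true → IsVertex G w → X w ≡ false → 3 ≤ cut G X
  cut≥3 {X} within Xv pw Xw = subst (3 ≤_) (cutSize≡cut G X) (tec X within (_ , Xv) (_ , pw , Xw))

  cut≥4 : ∀ {X} → Within G X → ∀ {v} → X v ≡ true → X a ≡ false → X b ≡ false → 4 ≤ cut G X
  cut≥4 {X} within Xv Xa Xb = 3≤even⇒4≤ (cut≥3 within Xv pb Xb) (trans (parity X) (cong₂ _xor_ Xa Xb))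

  tight-∌b : ∀ {X} → Tight G a X → X b ≡ false
  tight-∌b {X} (_ , Xa , cut≡3 , _) with X b in Xb
  ... | false = refl
  ... | true  = case trans (cong odd (sym cut≡3)) (trans (parity X) (cong₂ _xor_ Xa Xb)) of λ ()

  tight-∩ : ∀ {X Y} → Tight G a X → Tight G a Y → Tight G a (X ∩ Y)
  tight-∩ {X} {Y} tX@(wX , Xa , cutX , v , v≢a , Xv) tY@(wY , Ya , cutY , w , w≢a , Yw)
    with any? (λ u → ¬? (u ≟ a) ×-dec ((X ∩ Y) u ≟ᵇ true))
  ... | yes meet = within-∩ , XYa , ≤-antisym cut∩≤3 cut∩≥3 , meet
    where
    within-∩ : Within G (X ∩ Y)
    within-∩ u XYu = wX u (proj₁ (∧-true XYu))
    XYa : (X ∩ Y) a ≡ true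
    XYa = cong₂ _∧_ Xa Ya
    cut∩≥3 : 3 ≤ cut G (X ∩ Y)
    cut∩≥3 = cut≥3 within-∩ XYa pb (cong (_∧ Y b) (tight-∌b tX))
    cut∪≥3 : 3 ≤ cut G (X ∪ Y)
    cut∪≥3 = cut≥3 (λ u XYu → [ wX u , wY u ]′ (∨-true XYu)) (cong (_∨ Y a) Xa) pb
                   (cong₂ _∨_ (tight-∌b tX) (tight-∌b tY))
    cut∩≤3 : cut G (X ∩ Y) ≤ 3
    cut∩≤3 = +-cancelʳ-≤ 3 (cut G (X ∩ Y)) 3 (begin
      cut G (X ∩ Y) + 3             ≤⟨ +-monoʳ-≤ (cut G (X ∩ Y)) cut∪≥3 ⟩
      cut G (X ∩ Y) + cut G (X ∪ Y) ≤⟨ cut-submodular G X Y ⟩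
      cut G X + cut G Y             ≡⟨ cong₂ _+_ cutX cutY ⟩
      3 + 3                         ∎)
      where open ≤-Reasoning
  ... | no disjoint = ⊥-elim (<⇒≱ (≤ᵇ⇒≤ 7 8 _) (begin
      8                             ≤⟨ +-mono-≤ (cut≥4 (λ u → wX u ∘ proj₁ ∘ ∧-true) X∖Yv X∖Ya X∖Yb)
                                                (cut≥4 (λ u → wY u ∘ proj₁ ∘ ∧-true) Y∖Xw Y∖Xa Y∖Xb) ⟩
      cut G (X ∖ Y) + cut G (Y ∖ X) ≤⟨ cut-posimodular G X Y ⟩
      cut G X + cut G Y             ≡⟨ cong₂ _+_ cutX cutY ⟩
      6                             ∎))
    where
    open ≤-Reasoning
    outside : ∀ {u} → u ≢ a → (X ∩ Y) u ≢ true
    outside u≢a XYu = disjoint (_ , u≢a , XYu)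
    X∖Yv : (X ∖ Y) v ≡ true
    X∖Yv = cong₂ (λ p q → p ∧ not q) Xv (¬-not λ Yv → outside v≢a (cong₂ _∧_ Xv Yv))
    Y∖Xw : (Y ∖ X) w ≡ true
    Y∖Xw = cong₂ (λ p q → p ∧ not q) Yw (¬-not λ Xw → outside w≢a (cong₂ _∧_ Xw Yw))
    X∖Ya : (X ∖ Y) a ≡ false
    X∖Ya = trans (cong (λ q → X a ∧ not q) Ya) (∧-zeroʳ (X a))
    Y∖Xa : (Y ∖ X) a ≡ false
    Y∖Xa = trans (cong (λ q → Y a ∧ not q) Xa) (∧-zeroʳ (Y a))
    X∖Yb : (X ∖ Y) b ≡ false
    X∖Yb = cong (_∧ not (Y b)) (tight-∌b tX)
    Y∖Xb : (Y ∖ X) b ≡ false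
    Y∖Xb = cong (_∧ not (X b)) (tight-∌b tY)

  tight? : ∀ X → Dec (Tight G a X)
  tight? X = all? (λ v → (X v ≟ᵇ true) →-dec (present G v ≟ᵇ true)) ×-dec (X a ≟ᵇ true)
             ×-dec (cut G X ≟ℕ 3) ×-dec any? (λ v → ¬? (v ≟ a) ×-dec (X v ≟ᵇ true))

  tight-≗ : ∀ {X Y} → (∀ v → X v ≡ Y v) → Tight G a X → Tight G a Y
  tight-≗ X≗Y (within , Xa , cut≡3 , v , v≢a , Xv) =
    (λ u Yu → within u (trans (X≗Y u) Yu)) , trans (sym (X≗Y a)) Xa ,
    trans (sym (cut-≗ G X≗Y)) cut≡3 , v , v≢a , trans (sym (X≗Y v)) Xv

  Escapes : (Fin (n G) → Bool) → (Fin (n G) → Bool) → Set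
  Escapes X Y = Tight G a Y × ∃ λ v → X v ≡ true × Y v ≡ false

  least-tight : ∀ {X} → Tight G a X →
                ∃ λ L → Tight G a L × (∀ Y → Tight G a Y → ∀ v → L v ≡ true → Y v ≡ true)
  least-tight {X} tX = descend X tX (<-wellFounded (size X))
    where
    size : (Fin (n G) → Bool) → ℕ
    size X = sum (ind ∘ X)
    escapes? : ∀ X → Dec (∃ (Escapes X))
    escapes? X = anyBoolFun? (λ Y≗Y′ (tY , v , Xv , Yv) → tight-≗ Y≗Y′ tY , v , Xv , trans (sym (Y≗Y′ v)) Yv)
                              (λ Y → tight? Y ×-dec any? (λ v → (X v ≟ᵇ true) ×-dec (Y v ≟ᵇ false)))
    descend : ∀ X → Tight G a X → Acc _<_ (size X) →
              ∃ λ L → Tight G a L × (∀ Y → Tight G a Y → ∀ v → L v ≡ true → Y v ≡ true)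
    descend X tX (acc smaller) with escapes? X
    ... | yes (Y , tY , v , Xv , Yv) = descend (X ∩ Y) (tight-∩ tX tY)
      (smaller (sum-<-at (λ u → ind-∧-≤ (X u) (Y u)) v
                         (subst₂ (λ p q → ind (p ∧ q) < ind p) (sym Xv) (sym Yv) ≤-refl)))
    ... | no ¬escapes = X , tX , λ Y tY v Xv → ¬-not λ Yv → ¬escapes (Y , tY , v , Xv , Yv)

  tight-edge : ∀ {X} → Tight G a X → ∃ λ e → ∃ λ a′ → a′ ≢ a × X a′ ≡ true × Joins G e a a′
  tight-edge {X} tX@(within , Xa , cut≡3 , v , v≢a , Xv) =
    let e , gain = sum-<⇒∃< (λ e → crosses X (ends G e)) (λ e → crosses (X ∖ ⁅ a ⁆) (ends G e))
                            (subst (_< cut G (X ∖ ⁅ a ⁆)) (sym cut≡3) cut≥4-without-a)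
    in e , crosses-∖⁅⁆-< X a Xa (proj₁ (ends G e)) (proj₂ (ends G e)) gain
    where
    cut≥4-without-a : 4 ≤ cut G (X ∖ ⁅ a ⁆)
    cut≥4-without-a = cut≥4 (λ u → within u ∘ proj₁ ∘ ∧-true)
      (cong₂ (λ p q → p ∧ not q) Xv (dec-false (v ≟ a) v≢a))
      (trans (cong (λ q → X a ∧ not q) (dec-true (a ≟ a) refl)) (∧-zeroʳ (X a)))
      (cong (_∧ _) (tight-∌b tX))

  good-neighbour : IsVertex G a → (∃ λ w → IsVertex G w × w ≢ a) →
                   ∃ λ e → ∃ λ a′ → a′ ≢ a × Joins G e a a′ × (∀ Y → Tight G a Y → Y a′ ≡ true)
  good-neighbour pa (w , pw , w≢a) with anyBoolFun? tight-≗ tight?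
  ... | yes (X , tX) =
    let L , tL , least = least-tight tX
        e , a′ , a′≢a , La′ , joins = tight-edge tL
    in e , a′ , a′≢a , joins , λ Y tY → least Y tY a′ La′
  ... | no no-tight =
    let e , crosses>0 = sum-<⇒∃< (λ _ → 0) (λ e → crosses ⁅ a ⁆ (ends G e))
                                 (subst (_< cut G ⁅ a ⁆) (sym (sum-replicate-zero (m G)))
                                        (≤-trans (s≤s z≤n) (cut-⁅⁆≥3 G tec pa pw w≢a)))
        a′ , a′≢a , joins = crosses-⁅⁆->0 a (proj₁ (ends G e)) (proj₂ (ends G e)) crosses>0
    in e , a′ , a′≢a , joins , λ Y tY → ⊥-elim (no-tight (Y , tY))

-- Deleting an edge at a

ThreeEdgeConnectedAwayFrom : (G : Graph) → Fin (n G) → Set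
ThreeEdgeConnectedAwayFrom G a = ∀ X → Within G X → (∃ λ v → v ≢ a × X v ≡ true) →
                                 (∃ λ w → w ≢ a × IsVertex G w × X w ≡ false) → 3 ≤ cut G X

away-from⇒3-edge-connected : ∀ G {a} → WellFormed G → ThreeEdgeConnectedAwayFrom G a →
                             3 ≤ cut G ⁅ a ⁆ → ThreeEdgeConnected G
away-from⇒3-edge-connected G {a} wf away cut⁅a⁆≥3 X within (v , Xv) (w , pw , Xw)
  rewrite cutSize≡cut G X
  with any? (λ u → ¬? (u ≟ a) ×-dec (X u ≟ᵇ true))
     | any? (λ u → ¬? (u ≟ a) ×-dec (present G u ≟ᵇ true) ×-dec (X u ≟ᵇ false))
... | yes inner | yes outer = away X within inner outer
... | no no-inner | _ = subst (3 ≤_) (sym (cut-cong G wf X≐⁅a⁆)) cut⁅a⁆≥3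
  where
  X≐⁅a⁆ : ∀ u → IsVertex G u → X u ≡ ⁅ a ⁆ u
  X≐⁅a⁆ u _ with u ≟ a | v ≟ a
  ... | yes refl | yes refl = Xv
  ... | yes refl | no v≢a   = ⊥-elim (no-inner (v , v≢a , Xv))
  ... | no u≢a   | _        = ¬-not λ Xu → no-inner (u , u≢a , Xu)
... | yes _ | no no-outer = subst (3 ≤_) (sym (trans (cut-cong G wf X≐∁⁅a⁆) (cut-∁ G wf ⁅ a ⁆))) cut⁅a⁆≥3
  where
  X≐∁⁅a⁆ : ∀ u → IsVertex G u → X u ≡ ∁ G ⁅ a ⁆ u
  X≐∁⁅a⁆ u pu rewrite pu with u ≟ a | w ≟ a
  ... | yes refl | yes refl = Xw
  ... | yes refl | no w≢a   = ⊥-elim (no-outer (w , w≢a , pw , Xw))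
  ... | no u≢a   | _        = ¬-not λ Xu → no-outer (u , u≢a , pu , Xu)

deleteEdge-away-from : ∀ G {a a′ e} → WellFormed G → ThreeEdgeConnected G → IsVertex G a → Joins G e a a′ →
                       (∀ Y → Tight G a Y → Y a′ ≡ true) → ThreeEdgeConnectedAwayFrom (deleteEdge G e) a
deleteEdge-away-from G {a} {a′} {e} wf tec pa joins in-all-tight
                     Y within inner@(v , v≢a , Yv) (w , w≢a , pw , Yw)
  with 3 ≤? cut (deleteEdge G e) Y
... | yes cut≥3 = cut≥3
... | no cut≱3 = ⊥-elim (cut≱3 (subst (3 ≤_) cut-unchanged cutG≥3))
  where
  H = deleteEdge G e
  cutG≥3 : 3 ≤ cut G Y
  cutG≥3 = subst (3 ≤_) (cutSize≡cut G Y) (tec Y within (v , Yv) (w , pw , Yw))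
  cutG≡ : cut G Y ≡ ind (Y a xor Y a′) + cut H Y
  cutG≡ = trans (cut-deleteEdge G e Y) (cong (_+ cut H Y) (crosses-joins G Y joins))
  cutG≡3 : cut G Y ≡ 3
  cutG≡3 = ≤-antisym (subst (_≤ 3) (sym cutG≡) (+-mono-≤ (ind≤1 _) (≤-pred (≰⇒> cut≱3)))) cutG≥3
  same-side : Y a ≡ Y a′
  same-side with Y a in Ya
  ... | true  = sym (in-all-tight Y (within , Ya , cutG≡3 , inner))
  ... | false = sym (∁-excludes (in-all-tight (∁ G Y) tight-∁))
    where
    tight-∁ : Tight G a (∁ G Y)
    tight-∁ = (λ u → proj₁ ∘ ∧-true) , cong₂ (λ p q → p ∧ not q) pa Ya ,
              trans (cut-∁ G wf Y) cutG≡3 , w , w≢a , cong₂ (λ p q → p ∧ not q) pw Yw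
    ∁-excludes : ∁ G Y a′ ≡ true → Y a′ ≡ false
    ∁-excludes ∁Ya′ with Y a′
    ... | false = refl
    ... | true  = case trans (sym ∁Ya′) (∧-zeroʳ (present G a′)) of λ ()
  cut-unchanged : cut G Y ≡ cut H Y
  cut-unchanged = begin
    cut G Y                        ≡⟨ cutG≡ ⟩
    ind (Y a xor Y a′) + cut H Y   ≡⟨ cong (λ p → ind (p xor Y a′) + cut H Y) same-side ⟩
    ind (Y a′ xor Y a′) + cut H Y  ≡⟨ cong (λ p → ind p + cut H Y) (xor-same (Y a′)) ⟩
    cut H Y                        ∎
    where open ≡-Reasoning

module Smoothing {N k : ℕ} {pr : Fin N → Bool} {E : Fin (suc k) → Fin N × Fin N} {a a′ b : Fin N}
                 {f₁ f₂ : Fin (suc k)} (wf : WellFormed (graph N (suc k) pr E)) (pa′ : pr a′ ≡ true)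
                 (pb : pr b ≡ true) (a′≢a : a′ ≢ a) (deg : DegreeTwo (graph N (suc k) pr E) a f₁ f₂)
                 (trail : HasEulerianTrail (graph N (suc k) pr E) a′ b)
                 (away : ThreeEdgeConnectedAwayFrom (graph N (suc k) pr E) a) where

  H : Graph
  H = graph N (suc k) pr E

  open Incidence H a

  o₁ o₂ : Fin N
  o₁ = otherEnd H a f₁
  o₂ = otherEnd H a f₂

  f₁-incident : isIncident H a f₁ ≡ true
  f₁-incident = incident-∈ (subst (f₁ ∈_) (sym (proj₁ deg)) (here refl))

  f₂-incident : isIncident H a f₂ ≡ true
  f₂-incident = incident-∈ (subst (f₂ ∈_) (sym (proj₁ deg)) (there (here refl)))

  f₁-joins : Joins H f₁ a o₁ × o₁ ≢ a
  f₁-joins = otherEnd-joins f₁ f₁-incident (proj₁ (proj₂ deg))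

  f₂-joins : Joins H f₂ a o₂ × o₂ ≢ a
  f₂-joins = otherEnd-joins f₂ f₂-incident (proj₂ (proj₂ deg))

  f₁≢f₂ : f₁ ≢ f₂
  f₁≢f₂ with subst Unique (proj₁ deg) (Unique.filter⁺ (λ e → isIncident H a e ≟ᵇ true) (Unique.allFin⁺ (suc k)))
  ... | (f₁≢f₂ ∷ []) ∷ _ = f₁≢f₂

  incident-f₁f₂ : ∀ {g} → isIncident H a g ≡ true → g ≡ f₁ ⊎ g ≡ f₂
  incident-f₁f₂ inc with subst (_ ∈_) (proj₁ deg) (∈-incident inc)
  ... | here g≡f₁         = inj₁ g≡f₁
  ... | there (here g≡f₂) = inj₂ g≡f₂

  avoids-a : ∀ {g} → g ≢ f₁ → g ≢ f₂ → proj₁ (E g) ≢ a × proj₂ (E g) ≢ a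
  avoids-a {g} g≢f₁ g≢f₂ =
    (λ e₁≡a → excluded (step-incident (g , false) (inj₁ e₁≡a))) ,
    (λ e₂≡a → excluded (step-incident (g , false) (inj₂ e₂≡a)))
    where
    excluded : isIncident H a g ≡ true → ⊥
    excluded inc = [ g≢f₁ , g≢f₂ ]′ (incident-f₁f₂ inc)

  present′ : Fin N → Bool
  present′ u = if does (u ≟ a) then false else pr u

  newEnds : Fin (suc k) → Fin N × Fin N
  newEnds g = if does (g ≟ f₁) then (o₁ , o₂) else E g

  -- merge H a f₁ f₂ is, by definition, G′ with f₂ deleted, where G′ reroutes f₁ to join o₁ and o₂.
  G′ K : Graph
  G′ = graph N (suc k) present′ newEnds
  K  = merge H a f₁ f₂

  present′-a : present′ a ≡ false
  present′-a rewrite dec-true (a ≟ a) refl = refl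

  present′-≢ : ∀ {u} → u ≢ a → present′ u ≡ pr u
  present′-≢ {u} u≢a rewrite dec-false (u ≟ a) u≢a = refl

  present′-≢a : ∀ {u} → present′ u ≡ true → u ≢ a
  present′-≢a {u} p u≡a = case trans (sym p) (trans (cong present′ u≡a) present′-a) of λ ()

  newEnds-f₁ : newEnds f₁ ≡ (o₁ , o₂)
  newEnds-f₁ rewrite dec-true (f₁ ≟ f₁) refl = refl

  newEnds-≢ : ∀ {g} → g ≢ f₁ → newEnds g ≡ E g
  newEnds-≢ {g} g≢f₁ rewrite dec-false (g ≟ f₁) g≢f₁ = refl

  b≢a : b ≢ a
  b≢a b≡a = case trans (cong odd (sym (degreeTwo-cut deg)))
                 (trans (cut-parity H trail ⁅ a ⁆) (cong₂ _xor_ (dec-false (a′ ≟ a) a′≢a) (dec-true (b ≟ a) b≡a)))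
            of λ ()

  wf-K : WellFormed K
  wf-K j with punchIn f₂ j ≟ f₁
  ... | yes _ = kept (proj₂ f₁-joins) (joins-vertex H wf (proj₁ f₁-joins)) ,
                kept (proj₂ f₂-joins) (joins-vertex H wf (proj₁ f₂-joins))
    where
    kept : ∀ {u} → u ≢ a → pr u ≡ true → present′ u ≡ true
    kept u≢a pu = trans (present′-≢ u≢a) pu
  ... | no g≢f₁ = let e₁≢a , e₂≢a = avoids-a g≢f₁ (punchInᵢ≢i f₂ j)
                  in trans (present′-≢ e₁≢a) (proj₁ (wf _)) , trans (present′-≢ e₂≢a) (proj₂ (wf _))

  -- A vertex set X of K lifts to H with the same cut: a joins X iff both o₁ and o₂ lie in X.
  module _ (X : Fin N → Bool) (Xa : X a ≡ false) where

    lift : Fin N → Bool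
    lift u = X u ∨ (does (u ≟ a) ∧ (X o₁ ∧ X o₂))

    lift-≢ : ∀ {u} → u ≢ a → lift u ≡ X u
    lift-≢ {u} u≢a rewrite dec-false (u ≟ a) u≢a = ∨-identityʳ (X u)

    lift-a : lift a ≡ X o₁ ∧ X o₂
    lift-a rewrite Xa | dec-true (a ≟ a) refl = refl

    crosses-lift : ∀ {f o} → Joins H f a o → o ≢ a → crosses lift (E f) ≡ ind ((X o₁ ∧ X o₂) xor X o)
    crosses-lift joins o≢a = trans (crosses-joins H lift joins) (cong₂ (λ p q → ind (p xor q)) lift-a (lift-≢ o≢a))

    cut-merge : cut K X ≡ cut H lift
    cut-merge = begin
      sum (λ j → crosses X (newEnds (punchIn f₂ j)))
        ≡⟨ sum-bump (λ j → crosses X (newEnds (punchIn f₂ j))) (λ j → crosses lift (E (punchIn f₂ j))) j₁ agree bump ⟩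
      crosses lift (E f₂) + sum (λ j → crosses lift (E (punchIn f₂ j)))
        ≡⟨ sum-remove (λ g → crosses lift (E g)) ⟨
      cut H lift ∎
      where
      open ≡-Reasoning
      j₁ : Fin k
      j₁ = punchOut (f₁≢f₂ ∘ sym)
      agree : ∀ j → j ≢ j₁ → crosses X (newEnds (punchIn f₂ j)) ≡ crosses lift (E (punchIn f₂ j))
      agree j j≢j₁ = trans (cong (crosses X) (newEnds-≢ g≢f₁))
                           (cong₂ (λ p q → ind (p xor q)) (sym (lift-≢ e₁≢a)) (sym (lift-≢ e₂≢a)))
        where
        g≢f₁ : punchIn f₂ j ≢ f₁
        g≢f₁ g≡f₁ = j≢j₁ (punchIn-injective f₂ j j₁ (trans g≡f₁ (sym (punchIn-punchOut (f₁≢f₂ ∘ sym)))))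
        e₁≢a = proj₁ (avoids-a g≢f₁ (punchInᵢ≢i f₂ j))
        e₂≢a = proj₂ (avoids-a g≢f₁ (punchInᵢ≢i f₂ j))
      bump : crosses X (newEnds (punchIn f₂ j₁)) ≡ crosses lift (E f₂) + crosses lift (E (punchIn f₂ j₁))
      bump rewrite punchIn-punchOut (f₁≢f₂ ∘ sym) | newEnds-f₁
                 | crosses-lift (proj₁ f₁-joins) (proj₂ f₁-joins) | crosses-lift (proj₁ f₂-joins) (proj₂ f₂-joins)
                 = xor-split-bits (X o₁) (X o₂)

  tec-K : ThreeEdgeConnected K
  tec-K X within (v , Xv) (w , pw , Xw) = subst (3 ≤_) (sym (trans (cutSize≡cut K X) (cut-merge X Xa)))
    (away (lift X Xa) within-lift (v , v≢a , trans (lift-≢ X Xa v≢a) Xv)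
                                  (w , w≢a , pw-H , trans (lift-≢ X Xa w≢a) Xw))
    where
    Xa : X a ≡ false
    Xa = ¬-not λ a∈X → case trans (sym (within a a∈X)) present′-a of λ ()
    v≢a = present′-≢a (within v Xv)
    w≢a = present′-≢a pw
    pw-H : pr w ≡ true
    pw-H = trans (sym (present′-≢ w≢a)) pw
    within-lift : Within H (lift X Xa)
    within-lift u lift-u with ∨-true lift-u
    ... | inj₁ Xu = let u≢a = present′-≢a (within u Xu) in trans (sym (present′-≢ u≢a)) (within u Xu)
    ... | inj₂ at-a = subst (IsVertex H) (sym (does-true (u ≟ a) (proj₁ (∧-true at-a))))
                            (joins-vertex H wf (⊎-swap (proj₁ f₁-joins)))

  enters : ∀ {f o} s → proj₁ s ≡ f → Joins H f a o × o ≢ a → headO H s ≡ a → tailO H s ≡ o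
  enters s refl (joins , o≢a) hₛ with Trails.orient H s joins
  ... | inj₁ (_ , hₛ≡o) = ⊥-elim (o≢a (trans (sym hₛ≡o) hₛ))
  ... | inj₂ (tₛ≡o , _) = tₛ≡o

  leaves : ∀ {f o} s → proj₁ s ≡ f → Joins H f a o × o ≢ a → tailO H s ≡ a → headO H s ≡ o
  leaves s refl (joins , o≢a) tₛ with Trails.orient H s joins
  ... | inj₁ (_ , hₛ≡o) = hₛ≡o
  ... | inj₂ (tₛ≡o , _) = ⊥-elim (o≢a (trans (sym tₛ≡o) tₛ))

  reroute : ∀ P Q {y z} bit → WalkFromTo H a′ P y → tailO G′ (f₁ , bit) ≡ y → headO G′ (f₁ , bit) ≡ z →
            WalkFromTo H z Q b → All (_≢ f₁) (map proj₁ P ++ map proj₁ Q) →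
            f₂ ∷ f₁ ∷ map proj₁ P ++ map proj₁ Q ↭ allFin (suc k) → HasEulerianTrail K a′ b
  reroute P Q bit wP t≡ h≡ wQ avoid-f₁ rest↭ =
    trail-deleteEdge G′ (P′ ++ (f₁ , bit) ∷ Q′ , walk , ↭-trans (prep f₂ edges) rest↭)
    where
    P′ Q′ : List (Fin (suc k) × Bool)
    P′ = map (map₁ (λ g → g)) P
    Q′ = map (map₁ (λ g → g)) Q
    kept : ∀ {t} → All (_≢ f₁) (map proj₁ t) → All (λ s → newEnds (proj₁ s) ≡ E (proj₁ s)) t
    kept avoid = All.map⁻ (All.map newEnds-≢ avoid)
    walk : WalkFromTo G′ a′ (P′ ++ (f₁ , bit) ∷ Q′) b
    walk = Trails.walk-++ G′ (walk-relabel (λ g → g) wP (kept (All.++⁻ˡ (map proj₁ P) avoid-f₁)))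
             (t≡ , subst (λ x → WalkFromTo G′ x Q′ b) (sym h≡)
                         (walk-relabel (λ g → g) wQ (kept (All.++⁻ʳ (map proj₁ P) avoid-f₁))))
    edges : map proj₁ (P′ ++ (f₁ , bit) ∷ Q′) ↭ f₁ ∷ map proj₁ P ++ map proj₁ Q
    edges = begin
      map proj₁ (P′ ++ (f₁ , bit) ∷ Q′)     ≡⟨ map-++ proj₁ P′ _ ⟩
      map proj₁ P′ ++ f₁ ∷ map proj₁ Q′     ≡⟨ cong₂ (λ p q → p ++ f₁ ∷ q) (map-∘ P) (map-∘ Q) ⟨
      map proj₁ P ++ f₁ ∷ map proj₁ Q       ↭⟨ shift f₁ (map proj₁ P) (map proj₁ Q) ⟩
      f₁ ∷ map proj₁ P ++ map proj₁ Q       ∎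
      where open PermutationReasoning

  trail-K : HasEulerianTrail K a′ b
  trail-K with Trails.trail-passes H trail a′≢a b≢a (proj₁ f₁-joins)
  ... | Trails.passage P s₁ s₂ Q wP hₛ₁ tₛ₂ wQ edges =
    route (incident-f₁f₂ (step-incident s₁ (inj₂ hₛ₁))) (incident-f₁f₂ (step-incident s₂ (inj₁ tₛ₂)))
    where
    rest : List (Fin (suc k))
    rest = map proj₁ P ++ map proj₁ Q
    edges′ : proj₁ s₁ ∷ proj₁ s₂ ∷ rest ↭ allFin (suc k)
    edges′ = begin
      proj₁ s₁ ∷ proj₁ s₂ ∷ rest                        ↭⟨ shifts (map proj₁ P) (proj₁ s₁ ∷ proj₁ s₂ ∷ []) ⟨
      map proj₁ P ++ proj₁ s₁ ∷ proj₁ s₂ ∷ map proj₁ Q  ≡⟨ map-++ proj₁ P (s₁ ∷ s₂ ∷ Q) ⟨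
      map proj₁ (P ++ s₁ ∷ s₂ ∷ Q)                      ↭⟨ edges ⟩
      allFin (suc k)                                    ∎
      where open PermutationReasoning
    s₁-unique : All (_≢ proj₁ s₁) (proj₁ s₂ ∷ rest)
    s₁-unique = ↭-allFin-distinct edges′
    s₂-unique : All (_≢ proj₁ s₂) (proj₁ s₁ ∷ rest)
    s₂-unique = ↭-allFin-distinct (↭-trans (swap _ _ ↭-refl) edges′)
    route : proj₁ s₁ ≡ f₁ ⊎ proj₁ s₁ ≡ f₂ → proj₁ s₂ ≡ f₁ ⊎ proj₁ s₂ ≡ f₂ → HasEulerianTrail K a′ b
    route (inj₁ e₁≡f₁) (inj₁ e₂≡f₁) = ⊥-elim (All.head s₁-unique (trans e₂≡f₁ (sym e₁≡f₁)))
    route (inj₂ e₁≡f₂) (inj₂ e₂≡f₂) = ⊥-elim (All.head s₁-unique (trans e₂≡f₂ (sym e₁≡f₂)))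
    route (inj₁ e₁≡f₁) (inj₂ e₂≡f₂) = reroute P Q false wP
      (trans (cong proj₁ newEnds-f₁) (sym (enters s₁ e₁≡f₁ f₁-joins hₛ₁)))
      (trans (cong proj₂ newEnds-f₁) (sym (leaves s₂ e₂≡f₂ f₂-joins tₛ₂))) wQ
      (subst (λ f → All (_≢ f) rest) e₁≡f₁ (All.tail s₁-unique))
      (↭-trans (swap f₂ f₁ ↭-refl) (subst₂ (λ x y → x ∷ y ∷ rest ↭ allFin (suc k)) e₁≡f₁ e₂≡f₂ edges′))
    route (inj₂ e₁≡f₂) (inj₁ e₂≡f₁) = reroute P Q true wP
      (trans (cong proj₂ newEnds-f₁) (sym (enters s₁ e₁≡f₂ f₂-joins hₛ₁)))
      (trans (cong proj₁ newEnds-f₁) (sym (leaves s₂ e₂≡f₁ f₁-joins tₛ₂))) wQ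
      (subst (λ f → All (_≢ f) rest) e₂≡f₁ (All.tail s₂-unique))
      (subst₂ (λ x y → x ∷ y ∷ rest ↭ allFin (suc k)) e₁≡f₂ e₂≡f₁ edges′)

  valid : ValidInstance K a′ b
  valid = wf-K , trans (present′-≢ a′≢a) pa′ , trans (present′-≢ b≢a) pb , tec-K , trail-K

merge-valid : ∀ H {a a′ b f₁ f₂} → WellFormed H → IsVertex H a′ → IsVertex H b → a′ ≢ a →
              DegreeTwo H a f₁ f₂ → HasEulerianTrail H a′ b → ThreeEdgeConnectedAwayFrom H a →
              ValidInstance (merge H a f₁ f₂) a′ b
merge-valid (graph _ zero    _ _) {f₁ = ()}
merge-valid (graph _ (suc _) _ _) = Smoothing.valid

wf-deleteEdge : ∀ G e → WellFormed G → WellFormed (deleteEdge G e)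
wf-deleteEdge (graph _ (suc _) _ _) e wf = wf ∘ punchIn e

loopless-deleteEdge : ∀ G e {a} → Loopless G a → Loopless (deleteEdge G e) a
loopless-deleteEdge (graph _ (suc _) _ _) e loopless = loopless ∘ punchIn e

other-vertex : ∀ G {a} → WellFormed G → 1 ≤ m G → Loopless G a → ∃ λ w → IsVertex G w × w ≢ a
other-vertex (graph _ (suc _) _ E) {a} wf _ loopless with proj₁ (E zero) ≟ a | proj₂ (E zero) ≟ a
... | no u≢a   | _        = _ , proj₁ (wf zero) , u≢a
... | yes _    | no w≢a   = _ , proj₂ (wf zero) , w≢a
... | yes u≡a  | yes w≡a  = ⊥-elim (loopless zero (cong₂ _,_ u≡a w≡a))

Gₑ-valid-at-loop : ∀ G {a b e} → ValidInstance G a b → ends G e ≡ (a , a) → ValidInstance (Gₑ G a e) a b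
Gₑ-valid-at-loop G {a} {b} {e} (wf , pa , pb , tec , trail) loop =
  smooth-elim H a (λ D → ValidInstance (graphOf H D) a b)
    (λ _ → wf-H , pa , pb , tec-H , trail-H) degree-two-impossible
  where
  H = deleteEdge G e
  wf-H = wf-deleteEdge G e wf
  cut-unchanged : ∀ X → cut G X ≡ cut H X
  cut-unchanged X =
    trans (cut-deleteEdge G e X) (cong (_+ cut H X) (trans (cong (crosses X) loop) (cong ind (xor-same (X a)))))
  tec-H : ThreeEdgeConnected H
  tec-H X within inside outside =
    subst (3 ≤_) (trans (cutSize≡cut G X) (trans (cut-unchanged X) (sym (cutSize≡cut H X))))
                 (tec X within inside outside)
  trail-H : HasEulerianTrail H a b
  trail-H = trail-deleteEdge G (Trails.trail-without-loop G trail loop)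
  degree-two-impossible : ∀ f₁ f₂ → DegreeTwo H a f₁ f₂ → ValidInstance (merge H a f₁ f₂) a b
  degree-two-impossible f₁ f₂ deg@(L≡ , ℓ₁ , _) =
    case subst (3 ≤_) (trans (cut-unchanged ⁅ a ⁆) (degreeTwo-cut deg))
                      (cut-⁅⁆≥3 G tec pa (joins-vertex H wf-H joins) o≢a)
    of λ { (s≤s (s≤s ())) }
    where
    open Incidence H a
    joins-o = otherEnd-joins f₁ (incident-∈ (subst (f₁ ∈_) (sym L≡) (here refl))) ℓ₁
    joins = proj₁ joins-o
    o≢a = proj₂ joins-o

Gₑ-valid-at-neighbour : ∀ G {a b e a′} → ValidInstance G a b → Loopless G a → a′ ≢ a → Joins G e a a′ →
                        (∀ Y → Tight G a Y → Y a′ ≡ true) → ValidInstance (Gₑ G a e) a′ b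
Gₑ-valid-at-neighbour G {a} {b} {e} {a′} (wf , pa , pb , tec , trail) loopless a′≢a joins in-all-tight =
  smooth-elim H a (λ D → ValidInstance (graphOf H D) a′ b)
    (λ unsmoothable → wf-H , pa′ , pb , away-from⇒3-edge-connected H wf-H away (cut⁅a⁆≥3 unsmoothable) , trail-H)
    (λ f₁ f₂ deg → merge-valid H wf-H pa′ pb a′≢a deg trail-H away)
  where
  H = deleteEdge G e
  wf-H = wf-deleteEdge G e wf
  pa′ = joins-vertex G wf joins
  away = deleteEdge-away-from G wf tec pa joins in-all-tight
  trail-H : HasEulerianTrail H a′ b
  trail-H = trail-deleteEdge G (Trails.trail-without-edge G wf tec pa pb joins trail)
  cut⁅a⁆≥3 : ¬ Smoothable H a → 3 ≤ cut H ⁅ a ⁆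
  cut⁅a⁆≥3 unsmoothable =
    ≤∧≢⇒< cut⁅a⁆≥2 (unsmoothable ∘ cut-⁅⁆≡2⇒smoothable (loopless-deleteEdge G e loopless) ∘ sym)
    where
    open Incidence H a
    e-crosses : crosses ⁅ a ⁆ (ends G e) ≡ 1
    e-crosses rewrite crosses-joins G ⁅ a ⁆ joins | dec-true (a ≟ a) refl | dec-false (a′ ≟ a) a′≢a = refl
    cut⁅a⁆≥2 : 2 ≤ cut H ⁅ a ⁆
    cut⁅a⁆≥2 = ≤-pred (subst (3 ≤_) (trans (cut-deleteEdge G e ⁅ a ⁆) (cong (_+ cut H ⁅ a ⁆) e-crosses))
                             (cut-⁅⁆≥3 G tec pa pa′ a′≢a))

lemma2p3 : (G : Graph) (a b : Fin (n G)) → ValidInstance G a b → 1 ≤ m G →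
    ∃ λ (e : Fin (m G)) → ∃ λ (a′ : Fin (n G)) →
      (ends G e ≡ (a , a′) ⊎ ends G e ≡ (a′ , a)) × ValidInstance (Gₑ G a e) a′ b
lemma2p3 G a b vi@(wf , pa , pb , tec , trail) 1≤m with any? (λ e → ≡-dec _≟_ _≟_ (ends G e) (a , a))
... | yes (e , loop) = e , a , inj₁ loop , Gₑ-valid-at-loop G vi loop
... | no no-loop =
  let e , a′ , a′≢a , joins , in-all-tight =
        TightSets.good-neighbour G a b pb tec (cut-parity G trail) pa (other-vertex G wf 1≤m loopless)
  in e , a′ , joins , Gₑ-valid-at-neighbour G vi loopless a′≢a joins in-all-tight
  where
  loopless : Loopless G a
  loopless f loop = no-loop (f , loop)
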